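{- For every $n\ge0$, let $G_n(t,q,Y_0,Y_1,Z)=\sum_{w\in B_n}t^{\mathrm{fdes}\,w}q^{\mathrm{fmaj}\,w}Y_0^{\mathrm{fix}^+w}Y_1^{\mathrm{fix}^-w}Z^{\mathrm{neg}\,w}$. Then, as formal power series in $t$, $$\frac{1+t}{(t^2;q^2)_{n+1}}\,G_n(t,q,Y_0,Y_1,Z)=\sum_{s\ge0}t^s\sum_{\binom{c}{w}\in\mathrm{WSP}_n(s)}q^{\mathrm{tot}\,c}Y_0^{\mathrm{fix}^+w}Y_1^{\mathrm{fix}^-w}Z^{\mathrm{neg}\,w}.$$
   Context: $(a;q)_0=1$, $(a;q)_n=(1-a)(1-aq)\cdots(1-aq^{n-1})$; $\chi(A)=1$ if $A$ is true, $0$ otherwise. $B_n$ is the set of signed permutations $w=x_1\cdots x_n$ ($x_i\in\{\pm1,\dots,\pm n\}$, $|x_1|\cdots|x_n|$ a permutation of $1\cdots n$); $\mathrm{neg}\,w$ is the number of negative letters, $\mathrm{fix}^+w=\#\{i>0:x_i=i\}$, $\mathrm{fix}^-w=\#\{i>0:x_i=-i\}$, $\mathrm{des}\,w=\sum_{i=1}^{n-1}\chi(x_i>x_{i+1})$, $\mathrm{maj}\,w=\sum_{i=1}^{n-1}i\,\chi(x_i>x_{i+1})$, $\mathrm{fdes}\,w=2\,\mathrm{des}\,w+\chi(x_1<0)$, $\mathrm{fmaj}\,w=2\,\mathrm{maj}\,w+\mathrm{neg}\,w$. For a word $c=c_1\cdots c_n$, $\mathrm{tot}\,c=c_1+\cdots+c_n$.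 A weighted signed permutation of order $n$ is a pair $\binom{c}{w}$ where $c=c_1\cdots c_n$ is a nonincreasing word of nonnegative integers, $w=x_1\cdots x_n\in B_n$, $c_k=c_{k+1}\Rightarrow x_k<x_{k+1}$ for $1\le k<n$, and $x_k>0$ if $c_k$ is even, $x_k<0$ if $c_k$ is odd. $\mathrm{WSP}_n(s)$ is the set of those with $c_1\le s$. -}

module Defs where

open import Level using (Level)
open import Data.Bool using (Bool; true; false; if_then_else_)
open import Data.Nat as ℕ using (ℕ; zero; suc; _∸_; _≤_; _≥_; _≤?_; _≥?_)
open import Data.Nat.Divisibility using (_∣_; _∣?_)
open import Data.Integer as ℤ using (ℤ; +_; ∣_∣)
open import Data.List using (List; []; _∷_; [_]; map; concatMap; applyUpTo; upTo; filter; length; zip; zipWith; take; foldr; cartesianProduct)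
open import Data.Nat.ListAction using (sum)
open import Data.List.Relation.Unary.All using (All; all?)
open import Data.List.Relation.Unary.AllPairs using (AllPairs; allPairs?)
open import Data.List.Relation.Unary.Linked using (Linked; linked?)
open import Data.Product using (_×_; _,_; proj₁; proj₂)
open import Relation.Nullary using (Dec; yes; no; ¬_; ¬?; does)
open import Relation.Nullary.Decidable using (_×-dec_; _→-dec_)
open import Relation.Binary.PropositionalEquality using (_≡_; _≢_)
open import Algebra.Bundles using (CommutativeRing)

-- Words and signed permutations.
-- A signed permutation w = x₁⋯xₙ is a list of integers (letters ±1,…,±n,
-- ordered as integers: -n < ⋯ < -1 < 1 < ⋯ < n).

words : ∀ {a} {A : Set a} → ℕ → List A → List (List A)
words zero    as = [ [] ]
words (suc n) as = concatMap (λ x → map (x ∷_) (words n as)) as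

letters : ℕ → List ℤ
letters n = concatMap (λ k → + k ∷ ℤ.- (+ k) ∷ []) (applyUpTo suc n)

SignedPerm : ℕ → List ℤ → Set
SignedPerm n w =
  length w ≡ n × All (λ x → 1 ≤ ∣ x ∣ × ∣ x ∣ ≤ n) w × AllPairs (λ x y → ∣ x ∣ ≢ ∣ y ∣) w

signedPerm? : (n : ℕ) → (w : List ℤ) → Dec (SignedPerm n w)
signedPerm? n w =
  (length w ℕ.≟ n) ×-dec
  (all? (λ x → (1 ≤? ∣ x ∣) ×-dec (∣ x ∣ ≤? n)) w ×-dec
   allPairs? (λ x y → ¬? (∣ x ∣ ℕ.≟ ∣ y ∣)) w)

-- B_n, as a finite list (each signed permutation occurs exactly once)
B : ℕ → List (List ℤ)
B n = filter (signedPerm? n) (words n (letters n))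

χ : Bool → ℕ
χ true  = 1
χ false = 0

-- positions i (1-based, counting from i₀) with x_i > x_{i+1}
desPos : ℕ → List ℤ → List ℕ
desPos i (x ∷ y ∷ r) =
  if does (y ℤ.<? x) then i ∷ desPos (suc i) (y ∷ r) else desPos (suc i) (y ∷ r)
desPos i _ = []

des : List ℤ → ℕ
des w = length (desPos 1 w)

maj : List ℤ → ℕ
maj w = sum (desPos 1 w)

neg : List ℤ → ℕ
neg w = length (filter (λ x → x ℤ.<? + 0) w)

fixPlusFrom : ℕ → List ℤ → ℕ
fixPlusFrom i []       = 0
fixPlusFrom i (x ∷ xs) = χ (does (x ℤ.≟ + i)) ℕ.+ fixPlusFrom (suc i) xs

fixMinusFrom : ℕ → List ℤ → ℕ
fixMinusFrom i []       = 0
fixMinusFrom i (x ∷ xs) = χ (does (x ℤ.≟ ℤ.- (+ i))) ℕ.+ fixMinusFrom (suc i) xs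

fix⁺ : List ℤ → ℕ
fix⁺ = fixPlusFrom 1

fix⁻ : List ℤ → ℕ
fix⁻ = fixMinusFrom 1

firstNeg : List ℤ → ℕ
firstNeg []      = 0
firstNeg (x ∷ _) = χ (does (x ℤ.<? + 0))

fdes : List ℤ → ℕ
fdes w = 2 ℕ.* des w ℕ.+ firstNeg w

fmaj : List ℤ → ℕ
fmaj w = 2 ℕ.* maj w ℕ.+ neg w

tot : List ℕ → ℕ
tot = sum

Coupled : ℕ × ℤ → ℕ × ℤ → Set
Coupled (c , x) (c′ , y) = c ≡ c′ → x ℤ.< y

coupled? : ∀ p q → Dec (Coupled p q)
coupled? (c , x) (c′ , y) = (c ℕ.≟ c′) →-dec (x ℤ.<? y)

ParityOK : ℕ × ℤ → Set
ParityOK (c , x) = (2 ∣ c → + 0 ℤ.< x) × (¬ (2 ∣ c) → x ℤ.< + 0)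

parityOK? : ∀ p → Dec (ParityOK p)
parityOK? (c , x) = ((2 ∣? c) →-dec (+ 0 ℤ.<? x)) ×-dec (¬? (2 ∣? c) →-dec (x ℤ.<? + 0))

IsWSP : ℕ → ℕ → List ℕ × List ℤ → Set
IsWSP n s (c , w) =
  SignedPerm n w × length c ≡ n × Linked _≥_ c ×
  All (_≤ s) (take 1 c) ×                 -- c₁ ≤ s
  Linked Coupled (zip c w) × All ParityOK (zip c w)

isWSP? : ∀ n s p → Dec (IsWSP n s p)
isWSP? n s (c , w) =
  signedPerm? n w ×-dec (length c ℕ.≟ n) ×-dec linked? _≥?_ c ×-dec
  all? (_≤? s) (take 1 c) ×-dec linked? coupled? (zip c w) ×-dec all? parityOK? (zip c w)

-- WSP_n(s) as a finite list: filtered from all pairs (c , w) with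
-- c a word of length n over {0,…,s} (this contains every element of
-- WSP_n(s), since c nonincreasing with c₁ ≤ s) and w ∈ B_n.
WSP : ℕ → ℕ → List (List ℕ × List ℤ)
WSP n s = filter (isWSP? n s) (cartesianProduct (words n (upTo (suc s))) (B n))

-- Polynomials in q, Y₀, Y₁, Z are handled by letting q, Y₀, Y₁, Z be
-- arbitrary elements of an arbitrary commutative ring (taking
-- R = ℤ[q,Y₀,Y₁,Z] recovers the identity of polynomials).

module Series {c ℓ : Level} (R : CommutativeRing c ℓ) where
  open CommutativeRing R

  pow : Carrier → ℕ → Carrier
  pow x zero    = 1#
  pow x (suc k) = x * pow x k

  Σ : List Carrier → Carrier
  Σ = foldr _+_ 0#

  PS : Set c
  PS = ℕ → Carrier

  oneS : PS
  oneS zero    = 1#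
  oneS (suc _) = 0#

  tPow : ℕ → PS
  tPow m k = if does (m ℕ.≟ k) then 1# else 0#

  _⊕_ : PS → PS → PS
  (f ⊕ g) k = f k + g k

  _⊖_ : PS → PS → PS
  (f ⊖ g) k = f k - g k

  _·_ : Carrier → PS → PS
  (a · f) k = a * f k

  _⊛_ : PS → PS → PS
  (f ⊛ g) k = Σ (map (λ i → f i * g (k ∸ i)) (upTo (suc k)))

  -- Multiplicative inverse of a power series f with constant term 1:
  -- h₀ = 1, h_{m+1} = - Σ_{k=1}^{m+1} f_k h_{m+1-k}.
  -- invList f m = h_m ∷ h_{m-1} ∷ ⋯ ∷ h₀
  invList : PS → ℕ → List Carrier
  invList f zero    = [ 1# ]
  invList f (suc m) =
    (- Σ (zipWith _*_ (applyUpTo (λ k → f (suc k)) (suc m)) (invList f m))) ∷ invList f m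

  inv : PS → PS
  inv f m with invList f m
  ... | h ∷ _ = h
  ... | []    = 0#

  poch : PS → Carrier → ℕ → PS
  poch a b m = foldr (λ i acc → (oneS ⊖ (pow b i · a)) ⊛ acc) oneS (upTo m)

  termSeries : ∀ {a} {A : Set a} → (A → ℕ) → (A → Carrier) → List A → PS
  termSeries e w xs k = Σ (map (λ x → if does (e x ℕ.≟ k) then w x else 0#) xs)

  module _ (q Y₀ Y₁ Z : Carrier) where

    weight : List ℤ → Carrier
    weight w = pow Y₀ (fix⁺ w) * pow Y₁ (fix⁻ w) * pow Z (neg w)

    G : ℕ → PS
    G n = termSeries fdes (λ w → pow q (fmaj w) * weight w) (B n)

    LHS : ℕ → PS
    LHS n = ((oneS ⊕ tPow 1) ⊛ inv (poch (tPow 2) (q * q) (suc n))) ⊛ G n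

    RHS : ℕ → PS
    RHS n s = Σ (map (λ p → pow q (tot (proj₁ p)) * weight (proj₂ p)) (WSP n s))

module Submission where

-- The two sides agree word by word. Extracting coefficients of the Cauchy product, the
-- coefficient of t^s on the left is the sum over w ∈ B_n of q^(fmaj w) Y₀^(fix⁺ w) Y₁^(fix⁻ w)
-- Z^(neg w) h(s ∸ fdes w), where h = (1+t)/(t²;q²)_(n+1) has h_j = [n + ⌊j/2⌋ choose n]_(q²):
-- indeed 1/(t²;q²)_(m+1) is 1/(1−t²) times 1/(t²;q²)_m evaluated at qt. On the right, for fixed w
-- the weight words are summed letter by letter: each weight has the parity of the sign of its
-- letter, is at least the flag descent number of the suffix it starts, and
-- fmaj (x ∷ w) = fdes (x ∷ w) + fmaj w, so summing over the first weight reproduces the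
-- recursion [M + n + 1 choose n + 1] = Σ_(i ≤ M) q^(2i) [i + n choose n] of Gaussian coefficients.

open import Level using (Level)
open import Function using (_∘_; id; _⇔_; mk⇔; Equivalence)
open import Data.Bool using (Bool; true; false; if_then_else_; not; _∧_; T)
open import Data.Bool.Properties using (T-∧)
open import Data.Unit using (⊤; tt)
open import Data.Product using (_×_; _,_; proj₁; proj₂; ∃-syntax) renaming (map to map×)
open import Data.Nat as ℕ using (ℕ; zero; suc; _∸_; _≤_; _<_; z≤n; s≤s; _≤?_; _≟_; ⌊_/2⌋; parity)
import Data.Nat.Properties as ℕP
open import Data.Nat.Induction using (<-rec)
open import Data.Nat.Divisibility using (_∣_; divides; ∣m+n∣m⇒∣n; ∣m∣n⇒∣m+n; ∣-refl; ∣1⇒≡1)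
open import Data.Nat.ListAction using (sum)
open import Data.Nat.Tactic.RingSolver using (solve-∀)
open import Data.Parity as ℙ using (0ℙ; 1ℙ)
import Data.Parity.Properties as ℙP
open import Data.Integer as ℤ using (ℤ; ∣_∣)
import Data.Integer.Properties as ℤP
open import Data.List using (List; []; _∷_; map; applyUpTo; upTo; foldr; zipWith; zip; take; length; _++_; concatMap; filter; cartesianProduct)
import Data.List.Properties as ListP
open import Data.List.Relation.Unary.All as All using (All; []; _∷_)
open import Data.List.Relation.Unary.AllPairs using (AllPairs; []; _∷_)
open import Data.List.Relation.Unary.Linked using (Linked; []; [-]; _∷_)
open import Relation.Nullary using (Dec; yes; no; does; ¬_)
open import Relation.Nullary.Decidable using (dec-true; does-⇔; T?)
open import Relation.Nullary.Negation using (contradiction)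
open import Relation.Unary using (Pred; Decidable)
open import Relation.Binary.PropositionalEquality as P using (_≡_; _≢_)
import Relation.Binary.Reasoning.Setoid as SetoidReasoning
open import Algebra.Bundles using (CommutativeRing)
open import Defs

does-true : ∀ {p} {A : Set p} (a? : Dec A) → does a? ≡ true → A
does-true (yes a) _ = a

T-does : ∀ {p} {A : Set p} (a? : Dec A) → T (does a?) ⇔ A
T-does (yes a) = mk⇔ (λ _ → a) (λ _ → tt)
T-does (no ¬a) = mk⇔ (λ ()) ¬a

does-false : ∀ {p} {A : Set p} (a? : Dec A) → does a? ≡ false → ¬ A
does-false (no ¬a) _ = ¬a

∧-trueˡ : ∀ a {b} → a ∧ b ≡ true → a ≡ true
∧-trueˡ true _ = P.refl

does-suc≤?suc : ∀ m n → does (suc m ≤? suc n) ≡ does (m ≤? n)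
does-suc≤?suc m n = does-⇔ (mk⇔ ℕP.≤-pred s≤s) (suc m ≤? suc n) (m ≤? n)

zipWith-applyUpTo : ∀ {a b c} {A : Set a} {B : Set b} {C : Set c} (_∙_ : A → B → C) f g n →
  zipWith _∙_ (applyUpTo f n) (applyUpTo g n) ≡ applyUpTo (λ k → f k ∙ g k) n
zipWith-applyUpTo _∙_ f g zero = P.refl
zipWith-applyUpTo _∙_ f g (suc n) = P.cong (f 0 ∙ g 0 ∷_) (zipWith-applyUpTo _∙_ (f ∘ suc) (g ∘ suc) n)

double : ℕ → ℕ
double zero = zero
double (suc M) = suc (suc (double M))

data EvenOrOdd : ℕ → Set where
  even : ∀ M → EvenOrOdd (double M)
  odd : ∀ M → EvenOrOdd (suc (double M))

evenOrOdd : ∀ j → EvenOrOdd j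
evenOrOdd zero = even 0
evenOrOdd (suc zero) = odd 0
evenOrOdd (suc (suc j)) with evenOrOdd j
... | even M = even (suc M)
... | odd M = odd (suc M)

⌊double/2⌋ : ∀ M → ⌊ double M /2⌋ ≡ M
⌊double/2⌋ zero = P.refl
⌊double/2⌋ (suc M) = P.cong suc (⌊double/2⌋ M)

⌊1+double/2⌋ : ∀ M → ⌊ suc (double M) /2⌋ ≡ M
⌊1+double/2⌋ zero = P.refl
⌊1+double/2⌋ (suc M) = P.cong suc (⌊1+double/2⌋ M)

parity-double : ∀ M → parity (double M) ≡ 0ℙ
parity-double zero = P.refl
parity-double (suc M) = parity-double M

parity-suc-double : ∀ M → parity (suc (double M)) ≡ 1ℙ
parity-suc-double zero = P.refl
parity-suc-double (suc M) = parity-suc-double M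

parity-suc≢ : ∀ c → parity (suc c) ≢ parity c
parity-suc≢ c eq = ℙP.p≢p⁻¹ (parity (suc c)) (P.trans eq (P.sym (ℙP.suc-homo-⁻¹ c)))

parity-+-double : ∀ c M → parity (c ℕ.+ double M) ≡ parity c
parity-+-double c M = P.trans (ℙP.+-homo-+ c (double M))
  (P.trans (P.cong (parity c ℙ.+_) (parity-double M)) (ℙP.+-identityʳ (parity c)))

parity-+-suc-double≢ : ∀ c M → parity (c ℕ.+ suc (double M)) ≢ parity c
parity-+-suc-double≢ c M eq = ℙP.p≢p⁻¹ (parity c) (P.trans (P.sym eq) (P.trans (ℙP.+-homo-+ c (suc (double M)))
  (P.trans (P.cong (parity c ℙ.+_) (parity-suc-double M)) (ℙP.+-comm (parity c) 1ℙ))))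

⌊e+double/2⌋ : ∀ e M → e ≤ 1 → ⌊ e ℕ.+ double M /2⌋ ≡ M
⌊e+double/2⌋ zero M _ = ⌊double/2⌋ M
⌊e+double/2⌋ (suc zero) M _ = ⌊1+double/2⌋ M
⌊e+double/2⌋ (suc (suc _)) _ (s≤s ())

a≤c<a+e⇒c≡a : ∀ {a c} e → a ≤ c → c < a ℕ.+ e → e ≤ 1 → c ≡ a × a ℕ.+ e ≡ suc c
a≤c<a+e⇒c≡a {a} {c} zero a≤c c<a+0 _ = contradiction (P.subst (c <_) (ℕP.+-identityʳ a) c<a+0) (ℕP.≤⇒≯ a≤c)
a≤c<a+e⇒c≡a {a} {c} (suc zero) a≤c c<a+1 _ = c≡a , P.trans (ℕP.+-comm a 1) (P.cong suc (P.sym c≡a))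
  where c≡a = ℕP.≤-antisym (ℕP.≤-pred (P.subst (c <_) (ℕP.+-comm a 1) c<a+1)) a≤c
a≤c<a+e⇒c≡a (suc (suc _)) _ _ (s≤s ())

module FiniteSums {c ℓ : Level} (R : CommutativeRing c ℓ) where
  open CommutativeRing R hiding (zero)
  open Series R using (Σ)
  open import Algebra.Properties.CommutativeSemigroup +-commutativeSemigroup
    using () renaming (interchange to +-interchange)
  open import Relation.Binary.Reasoning.Setoid setoid

  guard : Bool → Carrier → Carrier
  guard b x = if b then x else 0#

  guard-yes : ∀ {p} {A : Set p} (a? : Dec A) → A → ∀ x → guard (does a?) x ≈ x
  guard-yes (yes _) _ _ = refl
  guard-yes (no ¬a) a _ = contradiction a ¬a

  guard-no : ∀ {p} {A : Set p} (a? : Dec A) → ¬ A → ∀ x → guard (does a?) x ≈ 0#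
  guard-no (yes a) ¬a _ = contradiction a ¬a
  guard-no (no _) _ _ = refl

  guard-cong : ∀ b {x y} → (b ≡ true → x ≈ y) → guard b x ≈ guard b y
  guard-cong true x≈y = x≈y P.refl
  guard-cong false _ = refl

  guard-*ˡ : ∀ b a x → guard b (a * x) ≈ a * guard b x
  guard-*ˡ true _ _ = refl
  guard-*ˡ false a _ = sym (zeroʳ a)

  guard-*ʳ : ∀ b a x → guard b x * a ≈ guard b (x * a)
  guard-*ʳ true _ _ = refl
  guard-*ʳ false a _ = zeroˡ a

  guard-0# : ∀ b → guard b 0# ≈ 0#
  guard-0# true = refl
  guard-0# false = refl

  guard-∧ : ∀ a b y → guard (a ∧ b) y ≡ guard a (guard b y)
  guard-∧ true _ _ = P.refl
  guard-∧ false _ _ = P.refl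

  guard-∧-* : ∀ a b x y → guard (a ∧ b) (x * y) ≈ guard a (x * guard b y)
  guard-∧-* true b x y = guard-*ˡ b x y
  guard-∧-* false _ _ _ = refl

  ∑< : ℕ → (ℕ → Carrier) → Carrier
  ∑< n f = Σ (applyUpTo f n)

  ∑∈ : ∀ {a} {A : Set a} → List A → (A → Carrier) → Carrier
  ∑∈ xs f = Σ (map f xs)

  infix 5 ∑< ∑∈
  syntax ∑< n (λ i → e) = ∑[ i < n ] e
  syntax ∑∈ xs (λ x → e) = ∑[ x ∈ xs ] e

  ∑<-cong : ∀ n {f g : ℕ → Carrier} → (∀ i → i < n → f i ≈ g i) → ∑< n f ≈ ∑< n g
  ∑<-cong zero _ = refl
  ∑<-cong (suc n) f≈g = +-cong (f≈g 0 (s≤s z≤n)) (∑<-cong n (λ i i<n → f≈g (suc i) (s≤s i<n)))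

  ∑<-cong′ : ∀ n {f g : ℕ → Carrier} → (∀ i → f i ≈ g i) → ∑< n f ≈ ∑< n g
  ∑<-cong′ n f≈g = ∑<-cong n (λ i _ → f≈g i)

  ∑<-zero : ∀ n {f : ℕ → Carrier} → (∀ i → i < n → f i ≈ 0#) → ∑< n f ≈ 0#
  ∑<-zero zero _ = refl
  ∑<-zero (suc n) f≈0 =
    trans (+-cong (f≈0 0 (s≤s z≤n)) (∑<-zero n (λ i i<n → f≈0 (suc i) (s≤s i<n)))) (+-identityˡ 0#)

  ∑<-single : ∀ n m {f : ℕ → Carrier} → m < n → (∀ i → i < n → i ≢ m → f i ≈ 0#) → ∑< n f ≈ f m
  ∑<-single (suc n) zero _ f≈0 =
    trans (+-cong refl (∑<-zero n (λ i i<n → f≈0 (suc i) (s≤s i<n) (λ ())))) (+-identityʳ _)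
  ∑<-single (suc n) (suc m) (s≤s m<n) f≈0 =
    trans (+-cong (f≈0 0 (s≤s z≤n) (λ ())) (∑<-single n m m<n (λ i i<n i≢m → f≈0 (suc i) (s≤s i<n) (i≢m ∘ ℕP.suc-injective))))
          (+-identityˡ _)

  ∑<-last : ∀ n f → ∑< (suc n) f ≈ ∑< n f + f n
  ∑<-last zero f = trans (+-identityʳ _) (sym (+-identityˡ _))
  ∑<-last (suc n) f = trans (+-cong refl (∑<-last n (f ∘ suc))) (sym (+-assoc _ _ _))

  ∑<-split : ∀ m r f → ∑< (m ℕ.+ r) f ≈ ∑< m f + ∑< r (λ i → f (m ℕ.+ i))
  ∑<-split zero r f = sym (+-identityˡ _)
  ∑<-split (suc m) r f = trans (+-cong refl (∑<-split m r (f ∘ suc))) (sym (+-assoc _ _ _))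

  ∑<-+ : ∀ n f g → ∑[ i < n ] (f i + g i) ≈ ∑< n f + ∑< n g
  ∑<-+ zero _ _ = sym (+-identityˡ 0#)
  ∑<-+ (suc n) f g = trans (+-cong refl (∑<-+ n (f ∘ suc) (g ∘ suc))) (+-interchange _ _ _ _)

  ∑<-*ˡ : ∀ n a f → a * ∑< n f ≈ ∑[ i < n ] (a * f i)
  ∑<-*ˡ zero a _ = zeroʳ a
  ∑<-*ˡ (suc n) a f = trans (distribˡ a _ _) (+-cong refl (∑<-*ˡ n a (f ∘ suc)))

  ∑<-*ʳ : ∀ n a f → ∑< n f * a ≈ ∑[ i < n ] (f i * a)
  ∑<-*ʳ n a f = trans (*-comm _ _) (trans (∑<-*ˡ n a f) (∑<-cong′ n (λ _ → *-comm _ _)))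

  ∑<-comm : ∀ m r (a : ℕ → ℕ → Carrier) → ∑[ i < m ] ∑< r (a i) ≈ ∑[ j < r ] ∑[ i < m ] a i j
  ∑<-comm zero r _ = sym (∑<-zero r (λ _ _ → refl))
  ∑<-comm (suc m) r a = trans (+-cong refl (∑<-comm m r (a ∘ suc))) (sym (∑<-+ r (a 0) _))

  ∑∈-cong : ∀ {a} {A : Set a} {f g : A → Carrier} xs → (∀ x → f x ≈ g x) → ∑∈ xs f ≈ ∑∈ xs g
  ∑∈-cong [] _ = refl
  ∑∈-cong (x ∷ xs) f≈g = +-cong (f≈g x) (∑∈-cong xs f≈g)

  ∑∈-zero : ∀ {a} {A : Set a} {f : A → Carrier} xs → (∀ x → f x ≈ 0#) → ∑∈ xs f ≈ 0#
  ∑∈-zero [] _ = refl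
  ∑∈-zero (x ∷ xs) f≈0 = trans (+-cong (f≈0 x) (∑∈-zero xs f≈0)) (+-identityˡ 0#)

  ∑∈-+ : ∀ {a} {A : Set a} (f g : A → Carrier) xs → ∑[ x ∈ xs ] (f x + g x) ≈ ∑∈ xs f + ∑∈ xs g
  ∑∈-+ f g [] = sym (+-identityˡ 0#)
  ∑∈-+ f g (x ∷ xs) = trans (+-cong refl (∑∈-+ f g xs)) (+-interchange _ _ _ _)

  ∑∈-*ˡ : ∀ {a} {A : Set a} k (f : A → Carrier) xs → k * ∑∈ xs f ≈ ∑[ x ∈ xs ] (k * f x)
  ∑∈-*ˡ k f [] = zeroʳ k
  ∑∈-*ˡ k f (x ∷ xs) = trans (distribˡ k _ _) (+-cong refl (∑∈-*ˡ k f xs))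

  ∑∈-*ʳ : ∀ {a} {A : Set a} k (f : A → Carrier) xs → ∑∈ xs f * k ≈ ∑[ x ∈ xs ] (f x * k)
  ∑∈-*ʳ k f xs = trans (*-comm _ _) (trans (∑∈-*ˡ k f xs) (∑∈-cong xs (λ _ → *-comm _ _)))

  ∑∈-comm : ∀ {a b} {A : Set a} {B : Set b} (f : A → B → Carrier) xs ys →
    ∑[ x ∈ xs ] ∑∈ ys (f x) ≈ ∑[ y ∈ ys ] ∑[ x ∈ xs ] f x y
  ∑∈-comm f [] ys = sym (∑∈-zero ys (λ _ → refl))
  ∑∈-comm f (x ∷ xs) ys = trans (+-cong refl (∑∈-comm f xs ys)) (sym (∑∈-+ (f x) _ ys))

  ∑∈-++ : ∀ {a} {A : Set a} (f : A → Carrier) xs ys → ∑∈ (xs ++ ys) f ≈ ∑∈ xs f + ∑∈ ys f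
  ∑∈-++ f [] ys = sym (+-identityˡ _)
  ∑∈-++ f (x ∷ xs) ys = trans (+-cong refl (∑∈-++ f xs ys)) (sym (+-assoc _ _ _))

  ∑∈-map : ∀ {a b} {A : Set a} {B : Set b} (f : B → Carrier) (g : A → B) xs → ∑∈ (map g xs) f ≡ ∑∈ xs (f ∘ g)
  ∑∈-map f g xs = P.cong Σ (P.sym (ListP.map-∘ xs))

  ∑∈-concatMap : ∀ {a b} {A : Set a} {B : Set b} (f : B → Carrier) (g : A → List B) xs →
    ∑∈ (concatMap g xs) f ≈ ∑[ x ∈ xs ] ∑∈ (g x) f
  ∑∈-concatMap f g [] = refl
  ∑∈-concatMap f g (x ∷ xs) = trans (∑∈-++ f (g x) (concatMap g xs)) (+-cong refl (∑∈-concatMap f g xs))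

  ∑∈-cartesianProduct : ∀ {a b} {A : Set a} {B : Set b} (f : A × B → Carrier) xs ys →
    ∑∈ (cartesianProduct xs ys) f ≈ ∑[ x ∈ xs ] ∑[ y ∈ ys ] f (x , y)
  ∑∈-cartesianProduct f [] ys = refl
  ∑∈-cartesianProduct f (x ∷ xs) ys =
    trans (∑∈-++ f (map (x ,_) ys) (cartesianProduct xs ys))
          (+-cong (reflexive (∑∈-map f (x ,_) ys)) (∑∈-cartesianProduct f xs ys))

  ∑∈-filter : ∀ {a p} {A : Set a} {Q : Pred A p} (Q? : Decidable Q) (f : A → Carrier) xs →
    ∑∈ (filter Q? xs) f ≈ ∑[ x ∈ xs ] guard (does (Q? x)) (f x)
  ∑∈-filter Q? f [] = refl
  ∑∈-filter Q? f (x ∷ xs) with Q? x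
  ... | yes _ = +-cong refl (∑∈-filter Q? f xs)
  ... | no _ = trans (∑∈-filter Q? f xs) (sym (+-identityˡ _))

  ∑∈-filter-cong : ∀ {a p} {A : Set a} {Q : Pred A p} (Q? : Decidable Q) {f g : A → Carrier} xs →
    (∀ x → Q x → f x ≈ g x) → ∑∈ (filter Q? xs) f ≈ ∑∈ (filter Q? xs) g
  ∑∈-filter-cong Q? [] _ = refl
  ∑∈-filter-cong Q? (x ∷ xs) f≈g with Q? x
  ... | yes qx = +-cong (f≈g x qx) (∑∈-filter-cong Q? xs f≈g)
  ... | no _ = ∑∈-filter-cong Q? xs f≈g

  ∑∈-upTo : ∀ n f → ∑∈ (upTo n) f ≡ ∑< n f
  ∑∈-upTo n f = P.cong Σ (ListP.map-upTo f n)

  ∑∈-guard : ∀ {a} {A : Set a} b x (g : A → Carrier) xs → ∑[ y ∈ xs ] guard b (x * g y) ≈ guard b (x * ∑∈ xs g)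
  ∑∈-guard true x g xs = sym (∑∈-*ˡ x g xs)
  ∑∈-guard false x g xs = ∑∈-zero xs (λ _ → refl)

  ∑<-∑∈-comm : ∀ {a} {A : Set a} n (f : ℕ → A → Carrier) xs →
    ∑[ i < n ] ∑∈ xs (f i) ≈ ∑[ x ∈ xs ] ∑[ i < n ] f i x
  ∑<-∑∈-comm n f [] = ∑<-zero n (λ _ _ → refl)
  ∑<-∑∈-comm n f (x ∷ xs) = trans (∑<-+ n (λ i → f i x) _) (+-cong refl (∑<-∑∈-comm n f xs))

  ∑<-pad : ∀ i k → i ≤ k → (u : ℕ → Carrier) →
    ∑< (suc i) u ≈ ∑[ j < suc k ] guard (does (j ≤? i)) (u j)
  ∑<-pad i k i≤k u = begin
      ∑< (suc i) u
        ≈⟨ sym (+-identityʳ _) ⟩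
      ∑< (suc i) u + 0#
        ≈⟨ +-cong (∑<-cong (suc i) below) (sym (∑<-zero (k ∸ i) above)) ⟩
      ∑< (suc i) v + (∑[ l < k ∸ i ] v (suc i ℕ.+ l))
        ≈⟨ sym (∑<-split (suc i) (k ∸ i) v) ⟩
      ∑< (suc i ℕ.+ (k ∸ i)) v
        ≡⟨ P.cong (λ n → ∑< (suc n) v) (ℕP.m+[n∸m]≡n i≤k) ⟩
      ∑< (suc k) v ∎
    where
    v = λ j → guard (does (j ≤? i)) (u j)
    below : ∀ j → j < suc i → u j ≈ v j
    below j (s≤s j≤i) = sym (guard-yes (j ≤? i) j≤i _)
    above : ∀ l → l < k ∸ i → v (suc i ℕ.+ l) ≈ 0#
    above l _ = guard-no (suc i ℕ.+ l ≤? i) (ℕP.<⇒≱ (ℕP.m≤m+n (suc i) l)) _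

  ∑<-shift : ∀ j k → j ≤ k → (w : ℕ → Carrier) →
    ∑[ i < suc k ] guard (does (j ≤? i)) (w i) ≈ ∑[ l < suc (k ∸ j) ] w (j ℕ.+ l)
  ∑<-shift j k j≤k w = begin
      ∑< (suc k) v
        ≡⟨ P.cong (λ n → ∑< n v) (P.sym j+[1+k∸j]≡1+k) ⟩
      ∑< (j ℕ.+ suc (k ∸ j)) v
        ≈⟨ ∑<-split j (suc (k ∸ j)) v ⟩
      ∑< j v + (∑[ l < suc (k ∸ j) ] v (j ℕ.+ l))
        ≈⟨ +-cong (∑<-zero j below) (∑<-cong′ (suc (k ∸ j)) above) ⟩
      0# + (∑[ l < suc (k ∸ j) ] w (j ℕ.+ l))
        ≈⟨ +-identityˡ _ ⟩
      ∑[ l < suc (k ∸ j) ] w (j ℕ.+ l) ∎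
    where
    v = λ i → guard (does (j ≤? i)) (w i)
    j+[1+k∸j]≡1+k : j ℕ.+ suc (k ∸ j) ≡ suc k
    j+[1+k∸j]≡1+k = P.trans (ℕP.+-suc j (k ∸ j)) (P.cong suc (ℕP.m+[n∸m]≡n j≤k))
    below : ∀ i → i < j → v i ≈ 0#
    below i i<j = guard-no (j ≤? i) (ℕP.<⇒≱ i<j) _
    above : ∀ l → v (j ℕ.+ l) ≈ w (j ℕ.+ l)
    above l = guard-yes (j ≤? j ℕ.+ l) (ℕP.m≤m+n j l) _

  ∑<-triangle : ∀ k (a : ℕ → ℕ → Carrier) →
    ∑[ i < suc k ] ∑[ j < suc i ] a i j ≈ ∑[ j < suc k ] ∑[ l < suc (k ∸ j) ] a (j ℕ.+ l) j
  ∑<-triangle k a = begin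
      ∑[ i < suc k ] ∑[ j < suc i ] a i j
        ≈⟨ ∑<-cong (suc k) (λ i i<1+k → ∑<-pad i k (ℕP.≤-pred i<1+k) (a i)) ⟩
      ∑[ i < suc k ] ∑[ j < suc k ] guard (does (j ≤? i)) (a i j)
        ≈⟨ ∑<-comm (suc k) (suc k) (λ i j → guard (does (j ≤? i)) (a i j)) ⟩
      ∑[ j < suc k ] ∑[ i < suc k ] guard (does (j ≤? i)) (a i j)
        ≈⟨ ∑<-cong (suc k) (λ j j<1+k → ∑<-shift j k (ℕP.≤-pred j<1+k) (λ i → a i j)) ⟩
      ∑[ j < suc k ] ∑[ l < suc (k ∸ j) ] a (j ℕ.+ l) j ∎

module PowerSeries {c ℓ : Level} (R : CommutativeRing c ℓ) where
  open CommutativeRing R hiding (zero)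
  open Series R
  open FiniteSums R
  open import Algebra.Properties.Ring ring using (-1*x≈-x; +-inverseˡ-unique)
  open import Algebra.Properties.CommutativeSemigroup *-commutativeSemigroup
    using () renaming (x∙yz≈xy∙z to *-assocˡ)
  open import Relation.Binary.Reasoning.Setoid setoid

  infix 4 _≋_
  _≋_ : PS → PS → Set ℓ
  f ≋ g = ∀ k → f k ≈ g k

  ⊛-coeff : ∀ f g k → (f ⊛ g) k ≡ ∑[ i < suc k ] (f i * g (k ∸ i))
  ⊛-coeff f g k = ∑∈-upTo (suc k) _

  ⊛-cong : ∀ {f f′ g g′} → f ≋ f′ → g ≋ g′ → f ⊛ g ≋ f′ ⊛ g′
  ⊛-cong {f} {f′} {g} {g′} f≋f′ g≋g′ k = begin
    (f ⊛ g) k                                ≡⟨ ⊛-coeff f g k ⟩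
    ∑[ i < suc k ] (f i * g (k ∸ i))         ≈⟨ ∑<-cong′ (suc k) (λ i → *-cong (f≋f′ i) (g≋g′ (k ∸ i))) ⟩
    ∑[ i < suc k ] (f′ i * g′ (k ∸ i))       ≡⟨ P.sym (⊛-coeff f′ g′ k) ⟩
    (f′ ⊛ g′) k                              ∎

  ⊛-congˡ : ∀ {f f′} g → f ≋ f′ → f ⊛ g ≋ f′ ⊛ g
  ⊛-congˡ g f≋f′ = ⊛-cong f≋f′ (λ _ → refl)

  ⊛-congʳ : ∀ f {g g′} → g ≋ g′ → f ⊛ g ≋ f ⊛ g′
  ⊛-congʳ f g≋g′ = ⊛-cong (λ _ → refl) g≋g′

  ⊛-assoc : ∀ f g h → (f ⊛ g) ⊛ h ≋ f ⊛ (g ⊛ h)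
  ⊛-assoc f g h k = begin
    ((f ⊛ g) ⊛ h) k
      ≡⟨ ⊛-coeff (f ⊛ g) h k ⟩
    ∑[ i < suc k ] ((f ⊛ g) i * h (k ∸ i))
      ≈⟨ ∑<-cong′ (suc k) (λ i → trans (*-congʳ (reflexive (⊛-coeff f g i)))
                                       (∑<-*ʳ (suc i) (h (k ∸ i)) (λ j → f j * g (i ∸ j)))) ⟩
    ∑[ i < suc k ] ∑[ j < suc i ] (f j * g (i ∸ j) * h (k ∸ i))
      ≈⟨ ∑<-triangle k (λ i j → f j * g (i ∸ j) * h (k ∸ i)) ⟩
    ∑[ j < suc k ] ∑[ l < suc (k ∸ j) ] (f j * g (j ℕ.+ l ∸ j) * h (k ∸ (j ℕ.+ l)))
      ≈⟨ ∑<-cong′ (suc k) (λ j → ∑<-cong′ (suc (k ∸ j)) (λ l → reindex j l)) ⟩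
    ∑[ j < suc k ] ∑[ l < suc (k ∸ j) ] (f j * (g l * h (k ∸ j ∸ l)))
      ≈⟨ ∑<-cong′ (suc k) (λ j → trans (sym (∑<-*ˡ (suc (k ∸ j)) (f j) (λ l → g l * h (k ∸ j ∸ l))))
                                       (*-congˡ (reflexive (P.sym (⊛-coeff g h (k ∸ j)))))) ⟩
    ∑[ j < suc k ] (f j * (g ⊛ h) (k ∸ j))
      ≡⟨ P.sym (⊛-coeff f (g ⊛ h) k) ⟩
    (f ⊛ (g ⊛ h)) k ∎
    where
    reindex : ∀ j l → f j * g (j ℕ.+ l ∸ j) * h (k ∸ (j ℕ.+ l)) ≈ f j * (g l * h (k ∸ j ∸ l))
    reindex j l = trans (*-assoc _ _ _)
      (reflexive (P.cong₂ (λ a b → f j * (g a * h b)) (ℕP.m+n∸m≡n j l) (P.sym (ℕP.∸-+-assoc k j l))))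

  ⊛-distribʳ-⊕ : ∀ f g h → (f ⊕ g) ⊛ h ≋ (f ⊛ h) ⊕ (g ⊛ h)
  ⊛-distribʳ-⊕ f g h k = begin
    ((f ⊕ g) ⊛ h) k
      ≡⟨ ⊛-coeff (f ⊕ g) h k ⟩
    ∑[ i < suc k ] ((f i + g i) * h (k ∸ i))
      ≈⟨ ∑<-cong′ (suc k) (λ i → distribʳ (h (k ∸ i)) (f i) (g i)) ⟩
    ∑[ i < suc k ] (f i * h (k ∸ i) + g i * h (k ∸ i))
      ≈⟨ ∑<-+ (suc k) (λ i → f i * h (k ∸ i)) (λ i → g i * h (k ∸ i)) ⟩
    (∑[ i < suc k ] (f i * h (k ∸ i))) + (∑[ i < suc k ] (g i * h (k ∸ i)))
      ≡⟨ P.sym (P.cong₂ _+_ (⊛-coeff f h k) (⊛-coeff g h k)) ⟩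
    (f ⊛ h) k + (g ⊛ h) k ∎

  ·-⊛ : ∀ a f g → (a · f) ⊛ g ≋ a · (f ⊛ g)
  ·-⊛ a f g k = begin
    ((a · f) ⊛ g) k                              ≡⟨ ⊛-coeff (a · f) g k ⟩
    ∑[ i < suc k ] (a * f i * g (k ∸ i))         ≈⟨ ∑<-cong′ (suc k) (λ i → *-assoc a (f i) (g (k ∸ i))) ⟩
    ∑[ i < suc k ] (a * (f i * g (k ∸ i)))       ≈⟨ sym (∑<-*ˡ (suc k) a (λ i → f i * g (k ∸ i))) ⟩
    a * (∑[ i < suc k ] (f i * g (k ∸ i)))       ≡⟨ P.cong (a *_) (P.sym (⊛-coeff f g k)) ⟩
    a * (f ⊛ g) k                                ∎

  ⊛-distribʳ-⊖ : ∀ f g h → (f ⊖ g) ⊛ h ≋ (f ⊛ h) ⊖ (g ⊛ h)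
  ⊛-distribʳ-⊖ f g h k = begin
    ((f ⊖ g) ⊛ h) k                                  ≈⟨ ⊛-congˡ h (λ i → +-congˡ (sym (-1*x≈-x _))) k ⟩
    ((f ⊕ ((- 1#) · g)) ⊛ h) k                        ≈⟨ ⊛-distribʳ-⊕ f ((- 1#) · g) h k ⟩
    (f ⊛ h) k + (((- 1#) · g) ⊛ h) k                   ≈⟨ +-congˡ (·-⊛ (- 1#) g h k) ⟩
    (f ⊛ h) k + - 1# * (g ⊛ h) k                      ≈⟨ +-congˡ (-1*x≈-x _) ⟩
    (f ⊛ h) k - (g ⊛ h) k                            ∎

  tPow-≡ : ∀ m → tPow m m ≈ 1#
  tPow-≡ m = guard-yes (m ≟ m) P.refl 1#

  tPow-≢ : ∀ m k → m P.≢ k → tPow m k ≈ 0#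
  tPow-≢ m k m≢k = guard-no (m ≟ k) m≢k 1#

  guard≈tPow* : ∀ m k a → guard (does (m ≟ k)) a ≈ tPow m k * a
  guard≈tPow* m k a = sym (trans (guard-*ʳ (does (m ≟ k)) a 1#) (guard-cong (does (m ≟ k)) (λ _ → *-identityˡ a)))

  oneS≋tPow0 : oneS ≋ tPow 0
  oneS≋tPow0 zero = refl
  oneS≋tPow0 (suc _) = refl

  tPow-⊛ : ∀ m h k → (tPow m ⊛ h) k ≈ guard (does (m ≤? k)) (h (k ∸ m))
  tPow-⊛ m h k = trans (reflexive (⊛-coeff (tPow m) h k)) (by-cases (m ≤? k))
    where
    u = λ i → tPow m i * h (k ∸ i)
    off : ∀ i → i P.≢ m → u i ≈ 0#
    off i i≢m = trans (*-congʳ (tPow-≢ m i (i≢m ∘ P.sym))) (zeroˡ _)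
    by-cases : (d : Dec (m ≤ k)) → ∑< (suc k) u ≈ guard (does d) (h (k ∸ m))
    by-cases (yes m≤k) = trans (∑<-single (suc k) m (s≤s m≤k) (λ i _ → off i)) (trans (*-congʳ (tPow-≡ m)) (*-identityˡ _))
    by-cases (no m≰k) = ∑<-zero (suc k) (λ i i<1+k → off i λ { P.refl → m≰k (ℕP.≤-pred i<1+k) })

  ⊛-tPow : ∀ m h k → (h ⊛ tPow m) k ≈ guard (does (m ≤? k)) (h (k ∸ m))
  ⊛-tPow m h k = trans (reflexive (⊛-coeff h (tPow m) k)) (by-cases (m ≤? k))
    where
    u = λ i → h i * tPow m (k ∸ i)
    off : ∀ i → m P.≢ k ∸ i → u i ≈ 0#
    off i m≢k∸i = trans (*-congˡ (tPow-≢ m (k ∸ i) m≢k∸i)) (zeroʳ _)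
    by-cases : (d : Dec (m ≤ k)) → ∑< (suc k) u ≈ guard (does d) (h (k ∸ m))
    by-cases (yes m≤k) = begin
      ∑< (suc k) u
        ≈⟨ ∑<-single (suc k) (k ∸ m) (s≤s (ℕP.m∸n≤m k m)) off-diagonal ⟩
      h (k ∸ m) * tPow m (k ∸ (k ∸ m))
        ≡⟨ P.cong (λ j → h (k ∸ m) * tPow m j) (ℕP.m∸[m∸n]≡n m≤k) ⟩
      h (k ∸ m) * tPow m m
        ≈⟨ trans (*-congˡ (tPow-≡ m)) (*-identityʳ _) ⟩
      h (k ∸ m) ∎
      where
      off-diagonal : ∀ i → i < suc k → i P.≢ k ∸ m → u i ≈ 0#
      off-diagonal i i<1+k i≢k∸m = off i λ m≡k∸i →
        i≢k∸m (P.trans (P.sym (ℕP.m∸[m∸n]≡n (ℕP.≤-pred i<1+k))) (P.cong (k ∸_) (P.sym m≡k∸i)))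
    by-cases (no m≰k) = ∑<-zero (suc k) (λ i _ → off i λ m≡k∸i → m≰k (P.subst (_≤ k) (P.sym m≡k∸i) (ℕP.m∸n≤m k i)))

  ⊛-identityˡ : ∀ f → oneS ⊛ f ≋ f
  ⊛-identityˡ f k = trans (⊛-congˡ f oneS≋tPow0 k) (tPow-⊛ 0 f k)

  ⊛-termSeries : ∀ {a} {A : Set a} h (e : A → ℕ) (v : A → Carrier) xs s →
    (h ⊛ termSeries e v xs) s ≈ ∑[ x ∈ xs ] guard (does (e x ≤? s)) (h (s ∸ e x) * v x)
  ⊛-termSeries h e v xs s = begin
    (h ⊛ termSeries e v xs) s
      ≡⟨ ⊛-coeff h (termSeries e v xs) s ⟩
    ∑[ i < suc s ] (h i * (∑[ x ∈ xs ] guard (does (e x ≟ s ∸ i)) (v x)))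
      ≈⟨ ∑<-cong′ (suc s) (λ i → trans (*-congˡ (∑∈-cong xs (λ x → guard≈tPow* (e x) (s ∸ i) (v x))))
                                       (∑∈-*ˡ (h i) (λ x → tPow (e x) (s ∸ i) * v x) xs)) ⟩
    ∑[ i < suc s ] ∑[ x ∈ xs ] (h i * (tPow (e x) (s ∸ i) * v x))
      ≈⟨ ∑<-∑∈-comm (suc s) (λ i x → h i * (tPow (e x) (s ∸ i) * v x)) xs ⟩
    ∑[ x ∈ xs ] ∑[ i < suc s ] (h i * (tPow (e x) (s ∸ i) * v x))
      ≈⟨ ∑∈-cong xs (λ x → trans (∑<-cong′ (suc s) (λ i → *-assocˡ (h i) (tPow (e x) (s ∸ i)) (v x)))
                                 (sym (∑<-*ʳ (suc s) (v x) (λ i → h i * tPow (e x) (s ∸ i))))) ⟩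
    ∑[ x ∈ xs ] ((∑[ i < suc s ] (h i * tPow (e x) (s ∸ i))) * v x)
      ≈⟨ ∑∈-cong xs (λ x → *-congʳ (reflexive (P.sym (⊛-coeff h (tPow (e x)) s)))) ⟩
    ∑[ x ∈ xs ] ((h ⊛ tPow (e x)) s * v x)
      ≈⟨ ∑∈-cong xs (λ x → trans (*-congʳ (⊛-tPow (e x) h s)) (guard-*ʳ _ (v x) _)) ⟩
    ∑[ x ∈ xs ] guard (does (e x ≤? s)) (h (s ∸ e x) * v x) ∎

  invList≡ : ∀ f m → invList f m ≡ applyUpTo (λ i → inv f (m ∸ i)) (suc m)
  invList≡ f zero = P.refl
  invList≡ f (suc m) = P.cong (inv f (suc m) ∷_) (invList≡ f m)

  inv-suc : ∀ f m → inv f (suc m) ≡ - (∑[ k < suc m ] (f (suc k) * inv f (m ∸ k)))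
  inv-suc f m = P.cong (-_ ∘ Σ) (P.trans
    (P.cong (zipWith _*_ (applyUpTo (f ∘ suc) (suc m))) (invList≡ f m))
    (zipWith-applyUpTo _*_ (f ∘ suc) (λ i → inv f (m ∸ i)) (suc m)))

  inv-unique : ∀ f g → f 0 ≈ 1# → f ⊛ g ≋ oneS → g ≋ inv f
  inv-unique f g f₀≈1 fg≋1 = <-rec (λ j → g j ≈ inv f j) step
    where
    g-by-f₀ : ∀ j → g j ≈ f 0 * g j
    g-by-f₀ j = trans (sym (*-identityˡ (g j))) (*-congʳ (sym f₀≈1))
    step : ∀ j → (∀ {i} → i < j → g i ≈ inv f i) → g j ≈ inv f j
    step zero _ = begin
      g 0                  ≈⟨ g-by-f₀ 0 ⟩
      f 0 * g 0            ≈⟨ +-identityʳ _ ⟨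
      (f ⊛ g) 0            ≈⟨ fg≋1 0 ⟩
      1#                   ∎
    step (suc m) ih = begin
      g (suc m)
        ≈⟨ g-by-f₀ (suc m) ⟩
      f 0 * g (suc m)
        ≈⟨ +-inverseˡ-unique _ _ (trans (reflexive (P.sym (⊛-coeff f g (suc m)))) (fg≋1 (suc m))) ⟩
      - (∑[ k < suc m ] (f (suc k) * g (m ∸ k)))
        ≈⟨ -‿cong (∑<-cong′ (suc m) (λ k → *-congˡ {f (suc k)} (ih (s≤s (ℕP.m∸n≤m m k))))) ⟩
      - (∑[ k < suc m ] (f (suc k) * inv f (m ∸ k)))
        ≡⟨ P.sym (inv-suc f m) ⟩
      inv f (suc m) ∎

module InversePochhammer {c ℓ : Level} (R : CommutativeRing c ℓ) (q : CommutativeRing.Carrier R) where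
  open CommutativeRing R hiding (zero)
  open Series R
  open FiniteSums R
  open PowerSeries R
  open import Algebra.Properties.Ring ring using (-0#≈0#; -‿distribʳ-*)
  open import Algebra.Properties.CommutativeSemigroup *-commutativeSemigroup
    using () renaming (interchange to *-interchange)
  open import Relation.Binary.Reasoning.Setoid setoid

  Q : Carrier
  Q = q * q

  pow-+ : ∀ x m n → pow x (m ℕ.+ n) ≈ pow x m * pow x n
  pow-+ x zero n = sym (*-identityˡ _)
  pow-+ x (suc m) n = trans (*-congˡ (pow-+ x m n)) (sym (*-assoc _ _ _))

  pow-double : ∀ M → pow q (double M) ≈ pow Q M
  pow-double zero = refl
  pow-double (suc M) = trans (sym (*-assoc _ _ _)) (*-congˡ (pow-double M))

  atQt : PS → PS
  atQt f k = pow q k * f k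

  atQt-cong : ∀ {f g} → f ≋ g → atQt f ≋ atQt g
  atQt-cong f≋g k = *-congˡ (f≋g k)

  atQt-⊛ : ∀ f g → atQt (f ⊛ g) ≋ atQt f ⊛ atQt g
  atQt-⊛ f g k = begin
    pow q k * (f ⊛ g) k
      ≡⟨ P.cong (pow q k *_) (⊛-coeff f g k) ⟩
    pow q k * (∑[ i < suc k ] (f i * g (k ∸ i)))
      ≈⟨ ∑<-*ˡ (suc k) (pow q k) (λ i → f i * g (k ∸ i)) ⟩
    ∑[ i < suc k ] (pow q k * (f i * g (k ∸ i)))
      ≈⟨ ∑<-cong (suc k) (λ i i<1+k → split-power i (ℕP.≤-pred i<1+k)) ⟩
    ∑[ i < suc k ] (atQt f i * atQt g (k ∸ i))
      ≡⟨ P.sym (⊛-coeff (atQt f) (atQt g) k) ⟩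
    (atQt f ⊛ atQt g) k ∎
    where
    split-power : ∀ i → i ≤ k → pow q k * (f i * g (k ∸ i)) ≈ atQt f i * atQt g (k ∸ i)
    split-power i i≤k = begin
      pow q k * (f i * g (k ∸ i))
        ≡⟨ P.cong (λ n → pow q n * (f i * g (k ∸ i))) (P.sym (ℕP.m+[n∸m]≡n i≤k)) ⟩
      pow q (i ℕ.+ (k ∸ i)) * (f i * g (k ∸ i))
        ≈⟨ *-congʳ (pow-+ q i (k ∸ i)) ⟩
      (pow q i * pow q (k ∸ i)) * (f i * g (k ∸ i))
        ≈⟨ *-interchange _ _ _ _ ⟩
      atQt f i * atQt g (k ∸ i) ∎

  atQt-oneS : atQt oneS ≋ oneS
  atQt-oneS zero = *-identityˡ _
  atQt-oneS (suc k) = zeroʳ _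

  factor : ℕ → PS
  factor i = oneS ⊖ (pow Q i · tPow 2)

  atQt-factor : ∀ i → atQt (factor i) ≋ factor (suc i)
  atQt-factor i k = begin
    pow q k * (oneS k - pow Q i * tPow 2 k)                ≈⟨ distribˡ _ _ _ ⟩
    pow q k * oneS k + pow q k * - (pow Q i * tPow 2 k)    ≈⟨ +-cong (atQt-oneS k) (sym (-‿distribʳ-* _ _)) ⟩
    oneS k - pow q k * (pow Q i * tPow 2 k)                ≈⟨ +-congˡ (-‿cong (shift k)) ⟩
    oneS k - pow Q (suc i) * tPow 2 k                      ∎
    where
    shift : ∀ k → pow q k * (pow Q i * tPow 2 k) ≈ pow Q (suc i) * tPow 2 k
    shift 2 = trans (*-congʳ (*-congˡ (*-identityʳ q))) (sym (*-assoc _ _ _))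
    shift 0 = trans (*-congˡ (zeroʳ _)) (trans (zeroʳ _) (sym (zeroʳ _)))
    shift 1 = trans (*-congˡ (zeroʳ _)) (trans (zeroʳ _) (sym (zeroʳ _)))
    shift (suc (suc (suc k))) = trans (*-congˡ (zeroʳ _)) (trans (zeroʳ _) (sym (zeroʳ _)))

  factors : List ℕ → PS
  factors = foldr (λ i acc → factor i ⊛ acc) oneS

  atQt-factors : ∀ is → atQt (factors is) ≋ factors (map suc is)
  atQt-factors [] = atQt-oneS
  atQt-factors (i ∷ is) k =
    trans (atQt-⊛ (factor i) (factors is) k) (⊛-cong (atQt-factor i) (atQt-factors is) k)

  poch-suc : ∀ m → poch (tPow 2) Q (suc m) ≋ factor 0 ⊛ atQt (poch (tPow 2) Q m)
  poch-suc m k = ⊛-congʳ (factor 0) (λ j → sym (trans (atQt-factors (upTo m) j)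
    (reflexive (P.cong (λ is → factors is j) (ListP.map-upTo suc m))))) k

  factor-⊛ : ∀ i h k → (factor i ⊛ h) k ≈ h k - pow Q i * guard (does (2 ≤? k)) (h (k ∸ 2))
  factor-⊛ i h k = begin
    ((oneS ⊖ (pow Q i · tPow 2)) ⊛ h) k
      ≈⟨ ⊛-distribʳ-⊖ oneS (pow Q i · tPow 2) h k ⟩
    (oneS ⊛ h) k - ((pow Q i · tPow 2) ⊛ h) k
      ≈⟨ +-cong (⊛-identityˡ h k) (-‿cong (·-⊛ (pow Q i) (tPow 2) h k)) ⟩
    h k - pow Q i * (tPow 2 ⊛ h) k
      ≈⟨ +-congˡ (-‿cong (*-congˡ (tPow-⊛ 2 h k))) ⟩
    h k - pow Q i * guard (does (2 ≤? k)) (h (k ∸ 2)) ∎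

  poch-head : ∀ m → poch (tPow 2) Q m 0 ≈ 1#
  poch-head zero = refl
  poch-head (suc m) = trans (poch-suc m 0) (trans (factor-⊛ 0 (atQt (poch (tPow 2) Q m)) 0)
    (trans (+-cong (trans (*-identityˡ _) (poch-head m)) (trans (-‿cong (zeroʳ _)) -0#≈0#)) (+-identityʳ _)))

  atT² : (ℕ → Carrier) → PS
  atT² g zero = g 0
  atT² g (suc zero) = 0#
  atT² g (suc (suc j)) = atT² (g ∘ suc) j

  atT²-double : ∀ g M → atT² g (double M) ≡ g M
  atT²-double g zero = P.refl
  atT²-double g (suc M) = atT²-double (g ∘ suc) M

  atT²-odd : ∀ g M → atT² g (suc (double M)) ≡ 0#
  atT²-odd g zero = P.refl
  atT²-odd g (suc M) = atT²-odd (g ∘ suc) M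

  geometricT² : PS
  geometricT² = atT² (λ _ → 1#)

  factor0-⊛-geometricT² : factor 0 ⊛ geometricT² ≋ oneS
  factor0-⊛-geometricT² k = trans (factor-⊛ 0 geometricT² k) (cancel k)
    where
    cancel : ∀ k → geometricT² k - pow Q 0 * guard (does (2 ≤? k)) (geometricT² (k ∸ 2)) ≈ oneS k
    cancel 0 = trans (+-congˡ (trans (-‿cong (zeroʳ _)) -0#≈0#)) (+-identityʳ _)
    cancel 1 = trans (+-congˡ (trans (-‿cong (zeroʳ _)) -0#≈0#)) (+-identityʳ _)
    cancel (suc (suc k)) = trans (+-congˡ (-‿cong (*-identityˡ _))) (-‿inverseʳ _)

  ⊛-geometricT²-suc-suc : ∀ a j → (a ⊛ geometricT²) (suc (suc j)) ≈ (a ⊛ geometricT²) j + a (suc (suc j))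
  ⊛-geometricT²-suc-suc a j = begin
    (a ⊛ geometricT²) (suc (suc j))
      ≡⟨ ⊛-coeff a geometricT² (suc (suc j)) ⟩
    ∑< (suc (suc (suc j))) u
      ≈⟨ ∑<-last (suc (suc j)) u ⟩
    ∑< (suc (suc j)) u + u (suc (suc j))
      ≈⟨ +-congʳ (∑<-last (suc j) u) ⟩
    ∑< (suc j) u + u (suc j) + u (suc (suc j))
      ≈⟨ +-cong (+-cong (∑<-cong (suc j) early) next-to-last) last ⟩
    (∑[ i < suc j ] (a i * geometricT² (j ∸ i))) + 0# + a (suc (suc j))
                                                                   ≈⟨ +-congʳ (+-identityʳ _) ⟩
    (∑[ i < suc j ] (a i * geometricT² (j ∸ i))) + a (suc (suc j))
      ≡⟨ P.cong (_+ a (suc (suc j))) (P.sym (⊛-coeff a geometricT² j)) ⟩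
    (a ⊛ geometricT²) j + a (suc (suc j)) ∎
    where
    u = λ i → a i * geometricT² (suc (suc j) ∸ i)
    early : ∀ i → i < suc j → u i ≈ a i * geometricT² (j ∸ i)
    early i (s≤s i≤j) = reflexive (P.cong (λ n → a i * geometricT² n) (ℕP.+-∸-assoc 2 i≤j))
    next-to-last : u (suc j) ≈ 0#
    next-to-last = trans (*-congˡ (reflexive (P.cong geometricT² (ℕP.m+n∸n≡m 1 (suc j))))) (zeroʳ _)
    last : u (suc (suc j)) ≈ a (suc (suc j))
    last = trans (*-congˡ (reflexive (P.cong geometricT² (ℕP.n∸n≡0 j)))) (*-identityʳ _)

  prefixSumQ : (ℕ → Carrier) → ℕ → Carrier
  prefixSumQ K M = ∑[ i < suc M ] (pow Q i * K i)

  -- invPochCoeff m M is the coefficient of u^M in 1/(u;Q)_m, a Gaussian binomial coefficient.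
  invPochCoeff : ℕ → ℕ → Carrier
  invPochCoeff zero = oneS
  invPochCoeff (suc m) = prefixSumQ (invPochCoeff m)

  atT²-invPochCoeff-suc : ∀ m → atT² (invPochCoeff (suc m)) ≋ atQt (atT² (invPochCoeff m)) ⊛ geometricT²
  atT²-invPochCoeff-suc m j = by-parity (evenOrOdd j)
    where
    a = atQt (atT² (invPochCoeff m))
    at-double : ∀ M → (a ⊛ geometricT²) (double M) ≈ invPochCoeff (suc m) M
    at-double zero = +-congʳ (*-identityʳ _)
    at-double (suc M) = begin
      (a ⊛ geometricT²) (double (suc M))
        ≈⟨ ⊛-geometricT²-suc-suc a (double M) ⟩
      (a ⊛ geometricT²) (double M) + pow q (double (suc M)) * atT² (invPochCoeff m) (double (suc M))
        ≈⟨ +-cong (at-double M) (*-cong (pow-double (suc M)) (reflexive (atT²-double (invPochCoeff m) (suc M)))) ⟩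
      invPochCoeff (suc m) M + pow Q (suc M) * invPochCoeff m (suc M)
        ≈⟨ ∑<-last (suc M) (λ i → pow Q i * invPochCoeff m i) ⟨
      invPochCoeff (suc m) (suc M) ∎
    at-odd : ∀ M → (a ⊛ geometricT²) (suc (double M)) ≈ 0#
    at-odd zero = trans (+-cong (zeroʳ _) (trans (+-identityʳ _) (trans (*-identityʳ _) (zeroʳ _)))) (+-identityʳ _)
    at-odd (suc M) = begin
      (a ⊛ geometricT²) (suc (double (suc M)))
        ≈⟨ ⊛-geometricT²-suc-suc a (suc (double M)) ⟩
      (a ⊛ geometricT²) (suc (double M)) + pow q (suc (double (suc M))) * atT² (invPochCoeff m) (suc (double (suc M)))
        ≈⟨ +-cong (at-odd M) (trans (*-congˡ (reflexive (atT²-odd (invPochCoeff m) (suc M)))) (zeroʳ _)) ⟩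
      0# + 0#
        ≈⟨ +-identityʳ _ ⟩
      0# ∎
    by-parity : ∀ {j} → EvenOrOdd j → atT² (invPochCoeff (suc m)) j ≈ (a ⊛ geometricT²) j
    by-parity (even M) = trans (reflexive (atT²-double (invPochCoeff (suc m)) M)) (sym (at-double M))
    by-parity (odd M) = trans (reflexive (atT²-odd (invPochCoeff (suc m)) M)) (sym (at-odd M))

  atT²-oneS : atT² oneS ≋ oneS
  atT²-oneS zero = refl
  atT²-oneS (suc zero) = refl
  atT²-oneS (suc (suc k)) = vanish k
    where
    vanish : ∀ k → atT² (λ _ → 0#) k ≈ 0#
    vanish zero = refl
    vanish (suc zero) = refl
    vanish (suc (suc k)) = vanish k

  poch-⊛-atT²-invPochCoeff : ∀ m → poch (tPow 2) Q m ⊛ atT² (invPochCoeff m) ≋ oneS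
  poch-⊛-atT²-invPochCoeff zero k = trans (⊛-congʳ oneS atT²-oneS k) (⊛-identityˡ oneS k)
  poch-⊛-atT²-invPochCoeff (suc m) k = begin
    (poch (tPow 2) Q (suc m) ⊛ atT² (invPochCoeff (suc m))) k
      ≈⟨ ⊛-cong (poch-suc m) (atT²-invPochCoeff-suc m) k ⟩
    ((factor 0 ⊛ atQt Π) ⊛ (atQt L ⊛ geometricT²)) k
      ≈⟨ ⊛-assoc (factor 0) (atQt Π) (atQt L ⊛ geometricT²) k ⟩
    (factor 0 ⊛ (atQt Π ⊛ (atQt L ⊛ geometricT²))) k
      ≈⟨ ⊛-congʳ (factor 0) (⊛-assoc (atQt Π) (atQt L) geometricT²) k ⟨
    (factor 0 ⊛ ((atQt Π ⊛ atQt L) ⊛ geometricT²)) k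
      ≈⟨ ⊛-congʳ (factor 0) (⊛-congˡ geometricT² (atQt-⊛ Π L)) k ⟨
    (factor 0 ⊛ (atQt (Π ⊛ L) ⊛ geometricT²)) k
      ≈⟨ ⊛-congʳ (factor 0) (⊛-congˡ geometricT² (λ i → trans (atQt-cong (poch-⊛-atT²-invPochCoeff m) i) (atQt-oneS i))) k ⟩
    (factor 0 ⊛ (oneS ⊛ geometricT²)) k
      ≈⟨ ⊛-congʳ (factor 0) (⊛-identityˡ geometricT²) k ⟩
    (factor 0 ⊛ geometricT²) k
      ≈⟨ factor0-⊛-geometricT² k ⟩
    oneS k ∎
    where
    Π = poch (tPow 2) Q m
    L = atT² (invPochCoeff m)

  inv-poch : ∀ m → inv (poch (tPow 2) Q m) ≋ atT² (invPochCoeff m)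
  inv-poch m k = sym (inv-unique (poch (tPow 2) Q m) (atT² (invPochCoeff m)) (poch-head m) (poch-⊛-atT²-invPochCoeff m) k)

  [1+t]/poch-coeff : ∀ m j → ((oneS ⊕ tPow 1) ⊛ inv (poch (tPow 2) Q m)) j ≈ invPochCoeff m ⌊ j /2⌋
  [1+t]/poch-coeff m j = begin
    ((oneS ⊕ tPow 1) ⊛ inv (poch (tPow 2) Q m)) j      ≈⟨ ⊛-congʳ (oneS ⊕ tPow 1) (inv-poch m) j ⟩
    ((oneS ⊕ tPow 1) ⊛ g) j                            ≈⟨ ⊛-distribʳ-⊕ oneS (tPow 1) g j ⟩
    (oneS ⊛ g) j + (tPow 1 ⊛ g) j                      ≈⟨ +-cong (⊛-identityˡ g j) (tPow-⊛ 1 g j) ⟩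
    g j + guard (does (1 ≤? j)) (g (j ∸ 1))            ≈⟨ pair j ⟩
    invPochCoeff m ⌊ j /2⌋                             ∎
    where
    g = atT² (invPochCoeff m)
    pair : ∀ j → g j + guard (does (1 ≤? j)) (g (j ∸ 1)) ≈ invPochCoeff m ⌊ j /2⌋
    pair j with evenOrOdd j
    ... | even zero = +-identityʳ _
    ... | even (suc M) = begin
      g (double (suc M)) + guard true (g (suc (double M)))
        ≡⟨ P.cong₂ _+_ (atT²-double (invPochCoeff m) (suc M)) (atT²-odd (invPochCoeff m) M) ⟩
      invPochCoeff m (suc M) + 0#
        ≈⟨ +-identityʳ _ ⟩
      invPochCoeff m (suc M)
        ≡⟨ P.cong (invPochCoeff m) (⌊double/2⌋ (suc M)) ⟨
      invPochCoeff m ⌊ double (suc M) /2⌋ ∎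
    ... | odd M = begin
      g (suc (double M)) + guard true (g (double M))
        ≡⟨ P.cong₂ _+_ (atT²-odd (invPochCoeff m) M) (atT²-double (invPochCoeff m) M) ⟩
      0# + invPochCoeff m M
        ≈⟨ +-identityˡ _ ⟩
      invPochCoeff m M
        ≡⟨ P.cong (invPochCoeff m) (⌊1+double/2⌋ M) ⟨
      invPochCoeff m ⌊ suc (double M) /2⌋ ∎

  ∑-atQt-atT² : ∀ B K → ∑< (suc B) (atQt (atT² K)) ≈ prefixSumQ K ⌊ B /2⌋
  ∑-atQt-atT² B K = by-parity (evenOrOdd B)
    where
    f = atQt (atT² K)
    odd-term : ∀ M → f (suc (double M)) ≈ 0#
    odd-term M = trans (*-congˡ (reflexive (atT²-odd K M))) (zeroʳ _)
    up-to-double : ∀ M → ∑< (suc (double M)) f ≈ ∑[ i < suc M ] (pow Q i * K i)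
    up-to-double zero = refl
    up-to-double (suc M) = begin
      ∑< (suc (suc (suc (double M)))) f
        ≈⟨ ∑<-last (suc (suc (double M))) f ⟩
      ∑< (suc (suc (double M))) f + f (double (suc M))
        ≈⟨ +-congʳ (∑<-last (suc (double M)) f) ⟩
      ∑< (suc (double M)) f + f (suc (double M)) + f (double (suc M))
        ≈⟨ +-cong (+-cong (up-to-double M) (odd-term M)) (*-cong (pow-double (suc M)) (reflexive (atT²-double K (suc M)))) ⟩
      (∑[ i < suc M ] (pow Q i * K i)) + 0# + pow Q (suc M) * K (suc M)
        ≈⟨ +-congʳ (+-identityʳ _) ⟩
      (∑[ i < suc M ] (pow Q i * K i)) + pow Q (suc M) * K (suc M)
        ≈⟨ ∑<-last (suc M) (λ i → pow Q i * K i) ⟨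
      ∑[ i < suc (suc M) ] (pow Q i * K i) ∎
    by-parity : ∀ {B} → EvenOrOdd B → ∑< (suc B) f ≈ prefixSumQ K ⌊ B /2⌋
    by-parity (even M) = trans (up-to-double M) (reflexive (P.cong (prefixSumQ K) (P.sym (⌊double/2⌋ M))))
    by-parity (odd M) = begin
      ∑< (suc (suc (double M))) f                   ≈⟨ ∑<-last (suc (double M)) f ⟩
      ∑< (suc (double M)) f + f (suc (double M))    ≈⟨ +-cong (up-to-double M) (odd-term M) ⟩
      (∑[ i < suc M ] (pow Q i * K i)) + 0#         ≈⟨ +-identityʳ _ ⟩
      prefixSumQ K M                                ≡⟨ P.cong (prefixSumQ K) (⌊1+double/2⌋ M) ⟨
      prefixSumQ K ⌊ suc (double M) /2⌋             ∎

  invPochCoeff-1 : ∀ M → invPochCoeff 1 M ≈ 1#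
  invPochCoeff-1 M = trans (+-cong (*-identityʳ _) (∑<-zero M (λ i _ → zeroʳ (pow Q (suc i))))) (+-identityʳ _)

module WordStatistics where
  open import Data.Nat using (_+_; _*_)
  open import Data.Integer using (+_)
  open P using (refl)
  open P.≡-Reasoning

  isNeg : ℤ → Bool
  isNeg x = does (x ℤ.<? + 0)

  χ≤1 : ∀ b → χ b ≤ 1
  χ≤1 true = s≤s z≤n
  χ≤1 false = z≤n

  length-if : ∀ b (x : ℕ) l → length (if b then x ∷ l else l) ≡ χ b + length l
  length-if true _ _ = refl
  length-if false _ _ = refl

  sum-if : ∀ b x l → sum (if b then x ∷ l else l) ≡ χ b * x + sum l
  sum-if true x l = P.cong (_+ sum l) (P.sym (ℕP.+-identityʳ x))
  sum-if false _ _ = refl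

  length-desPos-suc : ∀ i w → length (desPos (suc i) w) ≡ length (desPos i w)
  length-desPos-suc i [] = refl
  length-desPos-suc i (x ∷ []) = refl
  length-desPos-suc i (x ∷ y ∷ r) = begin
    length (desPos (suc i) (x ∷ y ∷ r))          ≡⟨ length-if b (suc i) _ ⟩
    χ b + length (desPos (suc (suc i)) (y ∷ r))  ≡⟨ P.cong (λ n → χ b + n) (length-desPos-suc (suc i) (y ∷ r)) ⟩
    χ b + length (desPos (suc i) (y ∷ r))        ≡⟨ length-if b i _ ⟨
    length (desPos i (x ∷ y ∷ r))                ∎
    where b = does (y ℤ.<? x)

  sum-desPos-suc : ∀ i w → sum (desPos (suc i) w) ≡ sum (desPos i w) + length (desPos i w)
  sum-desPos-suc i [] = refl
  sum-desPos-suc i (x ∷ []) = refl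
  sum-desPos-suc i (x ∷ y ∷ r) = begin
    sum (desPos (suc i) (x ∷ y ∷ r))
      ≡⟨ sum-if b (suc i) _ ⟩
    χ b * suc i + sum (desPos (suc (suc i)) (y ∷ r))
      ≡⟨ P.cong (λ n → χ b * suc i + n) (sum-desPos-suc (suc i) (y ∷ r)) ⟩
    χ b * suc i + (sum (desPos (suc i) (y ∷ r)) + length (desPos (suc i) (y ∷ r)))
                                                                 ≡⟨ shuffle (χ b) i _ _ ⟩
    (χ b * i + sum (desPos (suc i) (y ∷ r))) + (χ b + length (desPos (suc i) (y ∷ r)))
                                                                 ≡⟨ P.cong₂ _+_ (sum-if b i _) (length-if b i _) ⟨
    sum (desPos i (x ∷ y ∷ r)) + length (desPos i (x ∷ y ∷ r)) ∎
    where
    b = does (y ℤ.<? x)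
    shuffle : ∀ c i s l → c * suc i + (s + l) ≡ (c * i + s) + (c + l)
    shuffle = solve-∀

  des-∷∷ : ∀ x y r → des (x ∷ y ∷ r) ≡ χ (does (y ℤ.<? x)) + des (y ∷ r)
  des-∷∷ x y r = P.trans (length-if (does (y ℤ.<? x)) 1 _) (P.cong (λ n → χ (does (y ℤ.<? x)) + n) (length-desPos-suc 1 (y ∷ r)))

  maj-∷∷ : ∀ x y r → maj (x ∷ y ∷ r) ≡ χ (does (y ℤ.<? x)) + (maj (y ∷ r) + des (y ∷ r))
  maj-∷∷ x y r = P.trans (sum-if b 1 _) (P.cong₂ _+_ (ℕP.*-identityʳ (χ b)) (sum-desPos-suc 1 (y ∷ r)))
    where b = does (y ℤ.<? x)

  neg-∷ : ∀ x xs → neg (x ∷ xs) ≡ χ (isNeg x) + neg xs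
  neg-∷ x xs with x ℤ.<? + 0
  ... | yes _ = refl
  ... | no _ = refl

  fdes-∷∷ : ∀ x y r → fdes (x ∷ y ∷ r) ≡ 2 * (χ (does (y ℤ.<? x)) + des (y ∷ r)) + χ (isNeg x)
  fdes-∷∷ x y r = P.cong (λ d → 2 * d + χ (isNeg x)) (des-∷∷ x y r)

  fmaj-∷ : ∀ x xs → fmaj (x ∷ xs) ≡ fdes (x ∷ xs) + fmaj xs
  fmaj-∷ x [] = P.cong (λ k → 2 * 0 + k) (neg-∷ x [])
  fmaj-∷ x (y ∷ r) = begin
    2 * maj (x ∷ y ∷ r) + neg (x ∷ y ∷ r)
      ≡⟨ P.cong₂ (λ m k → 2 * m + k) (maj-∷∷ x y r) (neg-∷ x (y ∷ r)) ⟩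
    2 * (δ + (maj (y ∷ r) + des (y ∷ r))) + (χ (isNeg x) + neg (y ∷ r))
      ≡⟨ regroup δ (maj (y ∷ r)) (des (y ∷ r)) (χ (isNeg x)) (neg (y ∷ r)) ⟩
    (2 * (δ + des (y ∷ r)) + χ (isNeg x)) + (2 * maj (y ∷ r) + neg (y ∷ r))
      ≡⟨ P.cong (_+ fmaj (y ∷ r)) (P.sym (fdes-∷∷ x y r)) ⟩
    fdes (x ∷ y ∷ r) + fmaj (y ∷ r) ∎
    where
    δ = χ (does (y ℤ.<? x))
    regroup : ∀ d m n b k → 2 * (d + (m + n)) + (b + k) ≡ (2 * (d + n) + b) + (2 * m + k)
    regroup = solve-∀

  NonzeroAdjacentDistinct : List ℤ → Set
  NonzeroAdjacentDistinct w = All (_≢ + 0) w × Linked _≢_ w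

  signedPerm⇒nonzeroAdjacentDistinct : ∀ {n w} → SignedPerm n w → NonzeroAdjacentDistinct w
  signedPerm⇒nonzeroAdjacentDistinct {n} (_ , bounds , distinct) = nonzero bounds , adjacent distinct
    where
    nonzero : ∀ {w} → All (λ x → 1 ≤ ∣ x ∣ × ∣ x ∣ ≤ n) w → All (_≢ + 0) w
    nonzero [] = []
    nonzero ((1≤∣x∣ , _) ∷ bounds) = (λ { refl → contradiction 1≤∣x∣ λ () }) ∷ nonzero bounds
    adjacent : ∀ {w} → AllPairs (λ x y → ∣ x ∣ ≢ ∣ y ∣) w → Linked _≢_ w
    adjacent {[]} [] = []
    adjacent {x ∷ []} _ = [-]
    adjacent {x ∷ y ∷ r} ((∣x∣≢∣y∣ ∷ _) ∷ rest) = (∣x∣≢∣y∣ ∘ P.cong ∣_∣) ∷ adjacent rest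

  nonzeroAdjacentDistinct-tail : ∀ {x xs} → NonzeroAdjacentDistinct (x ∷ xs) → NonzeroAdjacentDistinct xs
  nonzeroAdjacentDistinct-tail {xs = []} (_ ∷ nonzero , _) = nonzero , []
  nonzeroAdjacentDistinct-tail {xs = _ ∷ _} (_ ∷ nonzero , _ ∷ distinct) = nonzero , distinct

  descends : ℤ → List ℤ → Bool
  descends x [] = false
  descends x (y ∷ _) = not (does (x ℤ.<? y))

  descends-∷ : ∀ {x y} r → x ≢ y → descends x (y ∷ r) ≡ does (y ℤ.<? x)
  descends-∷ {x} {y} r x≢y with x ℤ.<? y | y ℤ.<? x
  ... | yes x<y | yes y<x = contradiction x<y (ℤP.<-asym y<x)
  ... | yes _ | no _ = refl
  ... | no _ | yes _ = refl
  ... | no x≮y | no y≮x = contradiction (ℤP.≤-antisym (ℤP.≮⇒≥ y≮x) (ℤP.≮⇒≥ x≮y)) x≢y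

  minFirst : Bool → List ℤ → ℕ
  minFirst strict [] = 0
  minFirst strict w@(_ ∷ _) = fdes w + χ strict

  χ-gap : ∀ gt bx by → (gt ≡ true → bx ≡ true → by ≡ true) → (gt ≡ false → by ≡ true → bx ≡ true) →
    ∃[ e ] e ≤ 1 × χ gt + χ bx ≡ χ by + e
  χ-gap true true true _ _ = 1 , s≤s z≤n , refl
  χ-gap true true false x⇒y _ = contradiction (x⇒y refl refl) λ ()
  χ-gap true false true _ _ = 0 , z≤n , refl
  χ-gap true false false _ _ = 1 , s≤s z≤n , refl
  χ-gap false true true _ _ = 0 , z≤n , refl
  χ-gap false true false _ _ = 1 , s≤s z≤n , refl
  χ-gap false false true _ y⇒x = contradiction (y⇒x refl refl) λ ()
  χ-gap false false false _ _ = 0 , z≤n , refl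

  fdes-∷-minFirst : ∀ x xs → NonzeroAdjacentDistinct (x ∷ xs) →
    ∃[ e ] e ≤ 1 × fdes (x ∷ xs) ≡ minFirst (descends x xs) xs + e
  fdes-∷-minFirst x [] _ = χ (isNeg x) , χ≤1 (isNeg x) , refl
  fdes-∷-minFirst x (y ∷ r) (_ , x≢y ∷ _) =
    let e , e≤1 , gap = χ-gap (does (y ℤ.<? x)) (isNeg x) (isNeg y) neg-descent neg-ascent in
    e , e≤1 , (begin
      fdes (x ∷ y ∷ r)
        ≡⟨ fdes-∷∷ x y r ⟩
      2 * (χ (does (y ℤ.<? x)) + des (y ∷ r)) + χ (isNeg x)
        ≡⟨ rearrange _ (des (y ∷ r)) _ _ e gap ⟩
      fdes (y ∷ r) + χ (does (y ℤ.<? x)) + e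
        ≡⟨ P.cong (λ b → fdes (y ∷ r) + χ b + e) (descends-∷ r x≢y) ⟨
      minFirst (descends x (y ∷ r)) (y ∷ r) + e ∎)
    where
    neg-descent : does (y ℤ.<? x) ≡ true → isNeg x ≡ true → isNeg y ≡ true
    neg-descent y<x x<0 = dec-true (y ℤ.<? + 0) (ℤP.<-trans (does-true (y ℤ.<? x) y<x) (does-true (x ℤ.<? + 0) x<0))
    neg-ascent : does (y ℤ.<? x) ≡ false → isNeg y ≡ true → isNeg x ≡ true
    neg-ascent y≮x y<0 = dec-true (x ℤ.<? + 0) (ℤP.≤-<-trans (ℤP.≮⇒≥ (does-false (y ℤ.<? x) y≮x)) (does-true (y ℤ.<? + 0) y<0))
    rearrange : ∀ g D bx by e → g + bx ≡ by + e → 2 * (g + D) + bx ≡ 2 * D + by + g + e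
    rearrange g D bx by e gap = begin
      2 * (g + D) + bx         ≡⟨ regroupˡ g D bx ⟩
      2 * D + g + (g + bx)     ≡⟨ P.cong (λ n → 2 * D + g + n) gap ⟩
      2 * D + g + (by + e)     ≡⟨ regroupʳ g D by e ⟩
      2 * D + by + g + e       ∎
      where
      regroupˡ : ∀ g D bx → 2 * (g + D) + bx ≡ 2 * D + g + (g + bx)
      regroupˡ = solve-∀
      regroupʳ : ∀ g D by e → 2 * D + g + (by + e) ≡ 2 * D + by + g + e
      regroupʳ = solve-∀

  even⇒2∣ : ∀ c → parity c ≡ 0ℙ → 2 ∣ c
  even⇒2∣ zero _ = divides 0 refl
  even⇒2∣ (suc (suc c)) c-even = ∣m∣n⇒∣m+n {2} {2} {c} ∣-refl (even⇒2∣ c c-even)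

  odd⇒2∤ : ∀ c → parity c ≡ 1ℙ → ¬ 2 ∣ c
  odd⇒2∤ (suc zero) _ 2∣1 = contradiction (∣1⇒≡1 2∣1) λ ()
  odd⇒2∤ (suc (suc c)) c-odd 2∣2+c = odd⇒2∤ c c-odd (∣m+n∣m⇒∣n {2} {2} {c} 2∣2+c ∣-refl)

  parity-fdes-∷ : ∀ x xs → parity (fdes (x ∷ xs)) ≡ parity (χ (isNeg x))
  parity-fdes-∷ x xs = begin
    parity (2 * des (x ∷ xs) + χ (isNeg x))
      ≡⟨ ℙP.+-homo-+ (2 * des (x ∷ xs)) _ ⟩
    parity (2 * des (x ∷ xs)) ℙ.+ parity (χ (isNeg x))
      ≡⟨ P.cong (ℙ._+ parity (χ (isNeg x))) (ℙP.*-homo-* 2 (des (x ∷ xs))) ⟩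
    parity (χ (isNeg x)) ∎

  parityOK⇔ : ∀ {c x} → x ≢ + 0 → ParityOK (c , x) ⇔ parity c ≡ parity (χ (isNeg x))
  parityOK⇔ {c} {x} x≢0 with x ℤ.<? + 0
  ... | yes x<0 = mk⇔ to from
    where
    to : ParityOK (c , x) → parity c ≡ 1ℙ
    to (even⇒pos , _) with parity c in eq
    ... | 0ℙ = contradiction (even⇒pos (even⇒2∣ c eq)) (ℤP.<-asym x<0)
    ... | 1ℙ = refl
    from : parity c ≡ 1ℙ → ParityOK (c , x)
    from c-odd = (λ 2∣c → contradiction 2∣c (odd⇒2∤ c c-odd)) , (λ _ → x<0)
  ... | no x≮0 = mk⇔ to from
    where
    to : ParityOK (c , x) → parity c ≡ 0ℙ
    to (_ , odd⇒neg) with parity c in eq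
    ... | 0ℙ = refl
    ... | 1ℙ = contradiction (odd⇒neg (odd⇒2∤ c eq)) x≮0
    from : parity c ≡ 0ℙ → ParityOK (c , x)
    from c-even = (λ _ → ℤP.≤∧≢⇒< (ℤP.≮⇒≥ x≮0) (x≢0 ∘ P.sym)) , (λ 2∤c → contradiction (even⇒2∣ c c-even) 2∤c)

  does-parityOK? : ∀ c x xs → x ≢ + 0 → does (parityOK? (c , x)) ≡ does (parity c ℙP.≟ parity (fdes (x ∷ xs)))
  does-parityOK? c x xs x≢0 = does-⇔ (mk⇔
    (λ ok → P.trans (Equivalence.to (parityOK⇔ x≢0) ok) (P.sym (parity-fdes-∷ x xs)))
    (λ eq → Equivalence.from (parityOK⇔ x≢0) (P.trans eq (parity-fdes-∷ x xs))))
    (parityOK? (c , x)) (parity c ℙP.≟ parity (fdes (x ∷ xs)))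

module Compatibility where
  open WordStatistics
  open P using (refl)

  withinBound : Bool → ℕ → ℕ → Bool
  withinBound false c m = does (c ≤? m)
  withinBound true c m = does (suc c ≤? m)

  withinBound⇒≤ : ∀ strict {c m} → withinBound strict c m ≡ true → c ≤ m
  withinBound⇒≤ false {c} {m} ok = does-true (c ≤? m) ok
  withinBound⇒≤ true {c} {m} ok = ℕP.<⇒≤ (does-true (suc c ≤? m) ok)

  -- compatible m strict c w decides whether c is a weight word for w (in the sense of WSP) whose
  -- first entry is at most m, or less than m if strict; each later entry is bounded by the
  -- previous one, strictly exactly after a descent of w.
  compatible : ℕ → Bool → List ℕ → List ℤ → Bool
  compatible m strict [] [] = true
  compatible m strict (c ∷ cs) (x ∷ xs) =
    (withinBound strict c m ∧ does (parityOK? (c , x))) ∧ compatible c (descends x xs) cs xs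
  compatible m strict [] (_ ∷ _) = false
  compatible m strict (_ ∷ _) [] = false

  FirstWithin : ℕ → Bool → List ℕ → Set
  FirstWithin m strict [] = ⊤
  FirstWithin m strict (c ∷ _) = T (withinBound strict c m)

  CompatibleWeights : List ℕ → List ℤ → Set
  CompatibleWeights c w = Linked ℕ._≥_ c × Linked Coupled (zip c w) × All ParityOK (zip c w)

  within-descends⇔ : ∀ x y r c₁ c₂ → T (withinBound (descends x (y ∷ r)) c₂ c₁) ⇔ (c₂ ≤ c₁ × Coupled (c₁ , x) (c₂ , y))
  within-descends⇔ x y r c₁ c₂ with x ℤ.<? y
  ... | yes x<y = mk⇔ (λ c₂≤c₁ → Equivalence.to (T-does (c₂ ≤? c₁)) c₂≤c₁ , λ _ → x<y)
                      (Equivalence.from (T-does (c₂ ≤? c₁)) ∘ proj₁)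
  ... | no x≮y = mk⇔
    (λ c₂<c₁ → let c₂<c₁ = Equivalence.to (T-does (suc c₂ ≤? c₁)) c₂<c₁
               in ℕP.<⇒≤ c₂<c₁ , λ { refl → contradiction c₂<c₁ (ℕP.<-irrefl refl) })
    (λ (c₂≤c₁ , coupled) → Equivalence.from (T-does (suc c₂ ≤? c₁)) (ℕP.≤∧≢⇒< c₂≤c₁ (x≮y ∘ coupled ∘ P.sym)))

  compatible-sound : ∀ m strict c w → T (compatible m strict c w) →
    length c ≡ length w × FirstWithin m strict c × CompatibleWeights c w
  compatible-sound m strict [] [] _ = refl , tt , [] , [] , []
  compatible-sound m strict (c₁ ∷ cs) (x ∷ xs) ok
    with (within , parity-ok) , rest-ok ← map× (Equivalence.to T-∧) id (Equivalence.to T-∧ ok)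
    with len , first , ≥-cs , coupled-cs , parity-cs ← compatible-sound c₁ (descends x xs) cs xs rest-ok =
    P.cong suc len , within , tail cs xs len first (≥-cs , coupled-cs , parity-cs)
    where
    parity₁ = Equivalence.to (T-does (parityOK? (c₁ , x))) parity-ok
    tail : ∀ cs xs → length cs ≡ length xs → FirstWithin c₁ (descends x xs) cs → CompatibleWeights cs xs →
      CompatibleWeights (c₁ ∷ cs) (x ∷ xs)
    tail [] [] _ _ _ = [-] , [-] , parity₁ ∷ []
    tail (c₂ ∷ _) (y ∷ r) _ first (≥-cs , coupled-cs , parity-cs) =
      let c₂≤c₁ , coupled = Equivalence.to (within-descends⇔ x y r c₁ c₂) first
      in c₂≤c₁ ∷ ≥-cs , coupled ∷ coupled-cs , parity₁ ∷ parity-cs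

  compatible-complete : ∀ m strict c w → length c ≡ length w → FirstWithin m strict c → CompatibleWeights c w →
    T (compatible m strict c w)
  compatible-complete m strict [] [] _ _ _ = tt
  compatible-complete m strict (c₁ ∷ cs) (x ∷ xs) len within (≥-all , coupled-all , parity₁ ∷ parity-cs) =
    Equivalence.from T-∧ ( Equivalence.from T-∧ (within , Equivalence.from (T-does (parityOK? (c₁ , x))) parity₁)
                         , tail cs xs (ℕP.suc-injective len) ≥-all coupled-all parity-cs)
    where
    tail : ∀ cs xs → length cs ≡ length xs → Linked ℕ._≥_ (c₁ ∷ cs) → Linked Coupled (zip (c₁ ∷ cs) (x ∷ xs)) →
      All ParityOK (zip cs xs) → T (compatible c₁ (descends x xs) cs xs)
    tail [] [] _ _ _ _ = tt
    tail (c₂ ∷ cs′) (y ∷ r) len (c₂≤c₁ ∷ ≥-cs) (coupled ∷ coupled-cs) parity-cs =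
      compatible-complete c₁ (descends x (y ∷ r)) (c₂ ∷ cs′) (y ∷ r) len
        (Equivalence.from (within-descends⇔ x y r c₁ c₂) (c₂≤c₁ , coupled)) (≥-cs , coupled-cs , parity-cs)

  isWSP⇔compatible : ∀ {n s c w} → SignedPerm n w → IsWSP n s (c , w) ⇔ T (compatible s false c w)
  isWSP⇔compatible {n} {s} {c} {w} sp@(length-w , _) = mk⇔
    (λ (_ , length-c , ≥c , top , coupled , parities) →
      compatible-complete s false c w (P.trans length-c (P.sym length-w)) (top⇒first c top) (≥c , coupled , parities))
    (λ ok → let length≡ , first , ≥c , coupled , parities = compatible-sound s false c w ok
            in sp , P.trans length≡ length-w , ≥c , first⇒top c first , coupled , parities)
    where
    top⇒first : ∀ c → All (_≤ s) (take 1 c) → FirstWithin s false c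
    top⇒first [] _ = tt
    top⇒first (c₁ ∷ _) (c₁≤s ∷ []) = Equivalence.from (T-does (c₁ ≤? s)) c₁≤s
    first⇒top : ∀ c → FirstWithin s false c → All (_≤ s) (take 1 c)
    first⇒top [] _ = []
    first⇒top (c₁ ∷ _) c₁≤s = Equivalence.to (T-does (c₁ ≤? s)) c₁≤s ∷ []

  does-isWSP? : ∀ {n s c w} → SignedPerm n w → does (isWSP? n s (c , w)) ≡ compatible s false c w
  does-isWSP? {n} {s} {c} {w} sp = does-⇔ (isWSP⇔compatible sp) (isWSP? n s (c , w)) (T? (compatible s false c w))
module Counting {c ℓ : Level} (R : CommutativeRing c ℓ) (q : CommutativeRing.Carrier R) where
  open CommutativeRing R hiding (zero)
  open Series R
  open FiniteSums R
  open PowerSeries R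
  open InversePochhammer R q
  open WordStatistics
  open Compatibility
  open import Algebra.Properties.CommutativeSemigroup *-commutativeSemigroup
    using (x∙yz≈y∙xz; x∙yz≈z∙yx)
  open import Relation.Binary.Reasoning.Setoid setoid

  module _ (a e cmin : ℕ) (cmin≡a+e : cmin ≡ a ℕ.+ e) (e≤1 : e ≤ 1) (K : ℕ → Carrier) where

    parityClassTerm : ℕ → Carrier
    parityClassTerm c = guard (does (parity c ℙP.≟ parity cmin)) (pow q c * guard (does (a ≤? c)) (K ⌊ (c ∸ a) /2⌋))

    -- Below cmin only c = a passes the guard a ≤ c, and then cmin = suc c has the other parity.
    parityClassTerm-below : ∀ c → c < cmin → parityClassTerm c ≈ 0#
    parityClassTerm-below c c<cmin with a ≤? c
    ... | no a≰c = trans (guard-cong _ (λ _ → trans (*-congˡ (guard-no (a ≤? c) a≰c _)) (zeroʳ _))) (guard-0# _)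
    ... | yes a≤c = guard-no (parity c ℙP.≟ parity cmin) wrong-parity _
      where
      wrong-parity : parity c ≢ parity cmin
      wrong-parity eq with c≡a , a+e≡1+c ← a≤c<a+e⇒c≡a e a≤c (P.subst (c <_) cmin≡a+e c<cmin) e≤1 =
        parity-suc≢ c (P.trans (P.cong parity (P.trans (P.sym a+e≡1+c) (P.sym cmin≡a+e))) (P.sym eq))

    parityClassTerm-shift : ∀ j → parityClassTerm (cmin ℕ.+ j) ≈ pow q cmin * atQt (atT² K) j
    parityClassTerm-shift j = begin
      parityClassTerm (cmin ℕ.+ j)
        ≈⟨ guard-cong _ (λ _ → *-congˡ (guard-yes (a ≤? cmin ℕ.+ j) a≤cmin+j _)) ⟩
      guard (does (parity (cmin ℕ.+ j) ℙP.≟ parity cmin)) (pow q (cmin ℕ.+ j) * K ⌊ (cmin ℕ.+ j ∸ a) /2⌋)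
        ≡⟨ P.cong (λ n → guard (does (parity (cmin ℕ.+ j) ℙP.≟ parity cmin)) (pow q (cmin ℕ.+ j) * K ⌊ n /2⌋))
             cmin+j∸a≡e+j ⟩
      guard (does (parity (cmin ℕ.+ j) ℙP.≟ parity cmin)) (pow q (cmin ℕ.+ j) * K ⌊ (e ℕ.+ j) /2⌋)
        ≈⟨ by-parity (evenOrOdd j) ⟩
      pow q cmin * atQt (atT² K) j ∎
      where
      a≤cmin+j : a ≤ cmin ℕ.+ j
      a≤cmin+j = ℕP.≤-trans (ℕP.m≤m+n a e) (ℕP.≤-trans (ℕP.≤-reflexive (P.sym cmin≡a+e)) (ℕP.m≤m+n cmin j))
      cmin+j∸a≡e+j : cmin ℕ.+ j ∸ a ≡ e ℕ.+ j
      cmin+j∸a≡e+j = P.trans (P.cong (λ n → n ℕ.+ j ∸ a) cmin≡a+e)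
        (P.trans (P.cong (_∸ a) (ℕP.+-assoc a e j)) (ℕP.m+n∸m≡n a (e ℕ.+ j)))
      by-parity : ∀ {j} → EvenOrOdd j →
        guard (does (parity (cmin ℕ.+ j) ℙP.≟ parity cmin)) (pow q (cmin ℕ.+ j) * K ⌊ (e ℕ.+ j) /2⌋)
        ≈ pow q cmin * atQt (atT² K) j
      by-parity (even M) = begin
        guard (does (parity (cmin ℕ.+ double M) ℙP.≟ parity cmin)) (pow q (cmin ℕ.+ double M) * K ⌊ (e ℕ.+ double M) /2⌋)
          ≈⟨ guard-yes (parity (cmin ℕ.+ double M) ℙP.≟ parity cmin) (parity-+-double cmin M) _ ⟩
        pow q (cmin ℕ.+ double M) * K ⌊ (e ℕ.+ double M) /2⌋
          ≈⟨ *-cong (pow-+ q cmin (double M))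
                    (reflexive (P.trans (P.cong K (⌊e+double/2⌋ e M e≤1)) (P.sym (atT²-double K M)))) ⟩
        pow q cmin * pow q (double M) * atT² K (double M)
          ≈⟨ *-assoc _ _ _ ⟩
        pow q cmin * atQt (atT² K) (double M) ∎
      by-parity (odd M) = begin
        guard (does (parity (cmin ℕ.+ suc (double M)) ℙP.≟ parity cmin)) _
          ≈⟨ guard-no (parity (cmin ℕ.+ suc (double M)) ℙP.≟ parity cmin) (parity-+-suc-double≢ cmin M) _ ⟩
        0#
          ≈⟨ trans (*-congˡ (trans (*-congˡ (reflexive (atT²-odd K M))) (zeroʳ _))) (zeroʳ _) ⟨
        pow q cmin * atQt (atT² K) (suc (double M)) ∎

    ∑-parityClassTerm : ∀ b → ∑< (suc b) parityClassTerm ≈ guard (does (cmin ≤? b)) (pow q cmin * prefixSumQ K ⌊ (b ∸ cmin) /2⌋)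
    ∑-parityClassTerm b = by-bound (cmin ≤? b)
      where
      by-bound : (d : Dec (cmin ≤ b)) → ∑< (suc b) parityClassTerm ≈ guard (does d) (pow q cmin * prefixSumQ K ⌊ (b ∸ cmin) /2⌋)
      by-bound (no cmin≰b) = ∑<-zero (suc b) λ c c<1+b →
        parityClassTerm-below c (ℕP.≤-<-trans (ℕP.≤-pred c<1+b) (ℕP.≰⇒> cmin≰b))
      by-bound (yes cmin≤b) = begin
        ∑< (suc b) parityClassTerm
          ≡⟨ P.cong (λ n → ∑< n parityClassTerm) (P.sym cmin+[1+r]≡1+b) ⟩
        ∑< (cmin ℕ.+ suc r) parityClassTerm
          ≈⟨ ∑<-split cmin (suc r) parityClassTerm ⟩
        ∑< cmin parityClassTerm + (∑[ j < suc r ] parityClassTerm (cmin ℕ.+ j))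
          ≈⟨ +-cong (∑<-zero cmin parityClassTerm-below) (∑<-cong′ (suc r) parityClassTerm-shift) ⟩
        0# + (∑[ j < suc r ] (pow q cmin * atQt (atT² K) j))
          ≈⟨ +-identityˡ _ ⟩
        ∑[ j < suc r ] (pow q cmin * atQt (atT² K) j)
          ≈⟨ ∑<-*ˡ (suc r) (pow q cmin) (atQt (atT² K)) ⟨
        pow q cmin * ∑< (suc r) (atQt (atT² K))
          ≈⟨ *-congˡ (∑-atQt-atT² r K) ⟩
        pow q cmin * prefixSumQ K ⌊ r /2⌋ ∎
        where
        r = b ∸ cmin
        cmin+[1+r]≡1+b : cmin ℕ.+ suc r ≡ suc b
        cmin+[1+r]≡1+b = P.trans (ℕP.+-suc cmin r) (P.cong suc (ℕP.m+[n∸m]≡n cmin≤b))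

  -- The least weight word counted by weightSum m strict w consists of the flag descent numbers of
  -- the suffixes of w and has total fmaj w; the others add to it twice a nonincreasing word whose
  -- first entry is at most ⌊(m ∸ minFirst strict w)/2⌋, which yields closedForm.
  weightSum : ℕ → Bool → List ℤ → List ℕ → Carrier
  weightSum m strict w U = ∑[ cs ∈ words (length w) U ] guard (compatible m strict cs w) (pow q (tot cs))

  closedForm : ℕ → Bool → List ℤ → Carrier
  closedForm m strict w =
    guard (does (minFirst strict w ≤? m)) (pow q (fmaj w) * invPochCoeff (suc (length w)) ⌊ (m ∸ minFirst strict w) /2⌋)

  weightSum-∷ : ∀ m strict x xs U → weightSum m strict (x ∷ xs) U ≈
    ∑[ c₁ ∈ U ] guard (withinBound strict c₁ m ∧ does (parityOK? (c₁ , x))) (pow q c₁ * weightSum c₁ (descends x xs) xs U)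
  weightSum-∷ m strict x xs U = begin
    ∑∈ (concatMap (λ c₁ → map (c₁ ∷_) W) U) g
      ≈⟨ ∑∈-concatMap g (λ c₁ → map (c₁ ∷_) W) U ⟩
    ∑[ c₁ ∈ U ] ∑∈ (map (c₁ ∷_) W) g
      ≈⟨ ∑∈-cong U (λ c₁ → reflexive (∑∈-map g (c₁ ∷_) W)) ⟩
    ∑[ c₁ ∈ U ] ∑[ cs ∈ W ] g (c₁ ∷ cs)
      ≈⟨ ∑∈-cong U (λ c₁ → trans (∑∈-cong W (split-first c₁)) (∑∈-guard _ (pow q c₁) _ W)) ⟩
    ∑[ c₁ ∈ U ] guard (first c₁) (pow q c₁ * weightSum c₁ (descends x xs) xs U) ∎
    where
    W = words (length xs) U
    g = λ cs → guard (compatible m strict cs (x ∷ xs)) (pow q (tot cs))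
    first = λ c₁ → withinBound strict c₁ m ∧ does (parityOK? (c₁ , x))
    split-first : ∀ c₁ cs →
      g (c₁ ∷ cs) ≈ guard (first c₁) (pow q c₁ * guard (compatible c₁ (descends x xs) cs xs) (pow q (tot cs)))
    split-first c₁ cs = trans (guard-cong _ (λ _ → pow-+ q c₁ (tot cs))) (guard-∧-* (first c₁) _ _ _)

  ∑-first-weight : ∀ x xs → NonzeroAdjacentDistinct (x ∷ xs) → ∀ b →
    ∑[ c₁ < suc b ] guard (does (parityOK? (c₁ , x))) (pow q c₁ * closedForm c₁ (descends x xs) xs)
    ≈ guard (does (fdes (x ∷ xs) ≤? b)) (pow q (fmaj (x ∷ xs)) * invPochCoeff (suc (suc (length xs))) ⌊ (b ∸ fdes (x ∷ xs)) /2⌋)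
  ∑-first-weight x xs admissible b = begin
    ∑[ c₁ < suc b ] guard (does (parityOK? (c₁ , x))) (pow q c₁ * closedForm c₁ (descends x xs) xs)
      ≈⟨ ∑<-cong′ (suc b) factor-out ⟩
    ∑[ c₁ < suc b ] (F * f c₁)
      ≈⟨ ∑<-*ˡ (suc b) F f ⟨
    F * ∑< (suc b) f
      ≈⟨ *-congˡ (∑-parityClassTerm a e cmin cmin≡a+e e≤1 K b) ⟩
    F * guard (does (cmin ≤? b)) (pow q cmin * prefixSumQ K ⌊ (b ∸ cmin) /2⌋)
      ≈⟨ guard-*ˡ (does (cmin ≤? b)) F _ ⟨
    guard (does (cmin ≤? b)) (F * (pow q cmin * prefixSumQ K ⌊ (b ∸ cmin) /2⌋))
      ≈⟨ guard-cong (does (cmin ≤? b)) (λ _ → trans (sym (*-assoc _ _ _)) (*-congʳ merge-powers)) ⟩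
    guard (does (cmin ≤? b)) (pow q (fmaj (x ∷ xs)) * prefixSumQ K ⌊ (b ∸ cmin) /2⌋) ∎
    where
    a = minFirst (descends x xs) xs
    cmin = fdes (x ∷ xs)
    gap = fdes-∷-minFirst x xs admissible
    e = proj₁ gap
    e≤1 = proj₁ (proj₂ gap)
    cmin≡a+e = proj₂ (proj₂ gap)
    F = pow q (fmaj xs)
    K = invPochCoeff (suc (length xs))
    f = parityClassTerm a e cmin cmin≡a+e e≤1 K
    factor-out : ∀ c → guard (does (parityOK? (c , x))) (pow q c * closedForm c (descends x xs) xs) ≈ F * f c
    factor-out c = begin
      guard (does (parityOK? (c , x))) (pow q c * guard (does (a ≤? c)) (F * K ⌊ (c ∸ a) /2⌋))
        ≡⟨ P.cong (λ p → guard p (pow q c * guard (does (a ≤? c)) (F * K ⌊ (c ∸ a) /2⌋)))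
             (does-parityOK? c x xs (All.head (proj₁ admissible))) ⟩
      guard (does (parity c ℙP.≟ parity cmin)) (pow q c * guard (does (a ≤? c)) (F * K ⌊ (c ∸ a) /2⌋))
        ≈⟨ guard-cong _ (λ _ → trans (*-congˡ (guard-*ˡ (does (a ≤? c)) F _)) (x∙yz≈y∙xz _ _ _)) ⟩
      guard (does (parity c ℙP.≟ parity cmin)) (F * (pow q c * guard (does (a ≤? c)) (K ⌊ (c ∸ a) /2⌋)))
        ≈⟨ guard-*ˡ _ F _ ⟩
      F * f c ∎
    merge-powers : F * pow q cmin ≈ pow q (fmaj (x ∷ xs))
    merge-powers = trans (*-comm _ _) (trans (sym (pow-+ q cmin (fmaj xs))) (reflexive (P.cong (pow q) (P.sym (fmaj-∷ x xs)))))

  closedForm-∷ : ∀ x xs → NonzeroAdjacentDistinct (x ∷ xs) → ∀ strict m s → m ≤ s →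
    ∑[ c < suc s ] guard (withinBound strict c m ∧ does (parityOK? (c , x))) (pow q c * closedForm c (descends x xs) xs)
    ≈ closedForm m strict (x ∷ xs)
  closedForm-∷ x xs admissible strict m s m≤s = begin
    ∑[ c < suc s ] guard (withinBound strict c m ∧ does (parityOK? (c , x))) (weighted c)
      ≈⟨ ∑<-cong′ (suc s) (λ c → reflexive (guard-∧ (withinBound strict c m) (does (parityOK? (c , x))) (weighted c))) ⟩
    ∑[ c < suc s ] guard (withinBound strict c m) (term c)
      ≈⟨ by-strictness strict m m≤s ⟩
    closedForm m strict (x ∷ xs) ∎
    where
    weighted = λ c → pow q c * closedForm c (descends x xs) xs
    term = λ c → guard (does (parityOK? (c , x))) (weighted c)
    cmin = fdes (x ∷ xs)
    X = λ k → pow q (fmaj (x ∷ xs)) * invPochCoeff (suc (suc (length xs))) ⌊ k /2⌋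
    by-strictness : ∀ strict m → m ≤ s → ∑[ c < suc s ] guard (withinBound strict c m) (term c) ≈ closedForm m strict (x ∷ xs)
    by-strictness false m m≤s = begin
      ∑[ c < suc s ] guard (does (c ≤? m)) (term c)
        ≈⟨ ∑<-pad m s m≤s term ⟨
      ∑< (suc m) term
        ≈⟨ ∑-first-weight x xs admissible m ⟩
      guard (does (cmin ≤? m)) (X (m ∸ cmin))
        ≡⟨ P.cong (λ k → guard (does (k ≤? m)) (X (m ∸ k))) (ℕP.+-identityʳ cmin) ⟨
      closedForm m false (x ∷ xs) ∎
    by-strictness true zero _ = trans (∑<-zero (suc s) (λ _ _ → refl))
      (sym (guard-no (cmin ℕ.+ 1 ≤? 0) (λ cmin+1≤0 → ℕP.≤⇒≯ cmin+1≤0 (ℕP.<-≤-trans (s≤s z≤n) (ℕP.m≤n+m 1 cmin))) _))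
    by-strictness true (suc b) 1+b≤s = begin
      ∑[ c < suc s ] guard (does (suc c ≤? suc b)) (term c)
        ≈⟨ ∑<-cong′ (suc s) (λ c → reflexive (P.cong (λ d → guard d (term c)) (does-suc≤?suc c b))) ⟩
      ∑[ c < suc s ] guard (does (c ≤? b)) (term c)
        ≈⟨ ∑<-pad b s (ℕP.≤-trans (ℕP.n≤1+n b) 1+b≤s) term ⟨
      ∑< (suc b) term
        ≈⟨ ∑-first-weight x xs admissible b ⟩
      guard (does (cmin ≤? b)) (X (b ∸ cmin))
        ≡⟨ P.cong (λ d → guard d (X (b ∸ cmin))) (does-suc≤?suc cmin b) ⟨
      guard (does (suc cmin ≤? suc b)) (X (suc b ∸ suc cmin))
        ≡⟨ P.cong (λ k → guard (does (k ≤? suc b)) (X (suc b ∸ k))) (ℕP.+-comm 1 cmin) ⟩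
      closedForm (suc b) true (x ∷ xs) ∎

  weightSum≈closedForm : ∀ w → NonzeroAdjacentDistinct w → ∀ m strict s → m ≤ s →
    weightSum m strict w (upTo (suc s)) ≈ closedForm m strict w
  weightSum≈closedForm [] _ m strict s _ =
    trans (+-identityʳ _) (sym (trans (guard-yes (0 ≤? m) z≤n _) (trans (*-identityˡ _) (invPochCoeff-1 ⌊ m /2⌋))))
  weightSum≈closedForm (x ∷ xs) admissible m strict s m≤s = begin
    weightSum m strict (x ∷ xs) U
      ≈⟨ weightSum-∷ m strict x xs U ⟩
    ∑[ c₁ ∈ U ] guard (first c₁) (pow q c₁ * weightSum c₁ (descends x xs) xs U)
      ≈⟨ ∑∈-cong U (λ c₁ → guard-cong (first c₁) (λ ok → *-congˡ (weightSum≈closedForm xs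
           (nonzeroAdjacentDistinct-tail admissible) c₁ (descends x xs) s (c₁≤s c₁ ok)))) ⟩
    ∑[ c₁ ∈ U ] guard (first c₁) (pow q c₁ * closedForm c₁ (descends x xs) xs)
      ≡⟨ ∑∈-upTo (suc s) _ ⟩
    ∑[ c₁ < suc s ] guard (first c₁) (pow q c₁ * closedForm c₁ (descends x xs) xs)
      ≈⟨ closedForm-∷ x xs admissible strict m s m≤s ⟩
    closedForm m strict (x ∷ xs) ∎
    where
    U = upTo (suc s)
    first = λ c₁ → withinBound strict c₁ m ∧ does (parityOK? (c₁ , x))
    c₁≤s : ∀ c₁ → first c₁ ≡ true → c₁ ≤ s
    c₁≤s c₁ ok = ℕP.≤-trans (withinBound⇒≤ strict (∧-trueˡ (withinBound strict c₁ m) ok)) m≤s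

  minFirst-nonstrict : ∀ w → minFirst false w ≡ fdes w
  minFirst-nonstrict [] = P.refl
  minFirst-nonstrict (_ ∷ _) = ℕP.+-identityʳ _

  fdes-term≈∑-weights : ∀ n s w v → SignedPerm n w →
    guard (does (fdes w ≤? s)) (((oneS ⊕ tPow 1) ⊛ inv (poch (tPow 2) Q (suc n))) (s ∸ fdes w) * (pow q (fmaj w) * v))
    ≈ ∑[ c ∈ words n (upTo (suc s)) ] guard (does (isWSP? n s (c , w))) (pow q (tot c) * v)
  fdes-term≈∑-weights n s w v sp@(length≡n , _) = begin
    guard (does (fdes w ≤? s)) (((oneS ⊕ tPow 1) ⊛ inv (poch (tPow 2) Q (suc n))) (s ∸ fdes w) * (pow q (fmaj w) * v))
      ≈⟨ guard-cong _ (λ _ → trans (*-congʳ ([1+t]/poch-coeff (suc n) (s ∸ fdes w))) (x∙yz≈z∙yx _ _ _)) ⟩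
    guard (does (fdes w ≤? s)) (v * (pow q (fmaj w) * invPochCoeff (suc n) ⌊ (s ∸ fdes w) /2⌋))
      ≈⟨ guard-*ˡ _ v _ ⟩
    v * guard (does (fdes w ≤? s)) (pow q (fmaj w) * invPochCoeff (suc n) ⌊ (s ∸ fdes w) /2⌋)
      ≡⟨ P.cong₂ (λ a k → v * guard (does (a ≤? s)) (pow q (fmaj w) * invPochCoeff (suc k) ⌊ (s ∸ a) /2⌋))
           (P.sym (minFirst-nonstrict w)) (P.sym length≡n) ⟩
    v * closedForm s false w
      ≈⟨ *-comm _ _ ⟩
    closedForm s false w * v
      ≈⟨ *-congʳ (weightSum≈closedForm w (signedPerm⇒nonzeroAdjacentDistinct sp) s false s ℕP.≤-refl) ⟨
    weightSum s false w U * v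
      ≡⟨ P.cong (λ k → (∑[ c ∈ words k U ] guard (compatible s false c w) (pow q (tot c))) * v) length≡n ⟩
    (∑[ c ∈ words n U ] guard (compatible s false c w) (pow q (tot c))) * v
      ≈⟨ ∑∈-*ʳ v _ (words n U) ⟩
    ∑[ c ∈ words n U ] (guard (compatible s false c w) (pow q (tot c)) * v)
      ≈⟨ ∑∈-cong (words n U) (λ c → trans (guard-*ʳ (compatible s false c w) v _)
           (reflexive (P.cong (λ b → guard b (pow q (tot c) * v)) (P.sym (does-isWSP? {s = s} {c = c} sp))))) ⟩
    ∑[ c ∈ words n U ] guard (does (isWSP? n s (c , w))) (pow q (tot c) * v) ∎
    where
    U = upTo (suc s)

proposition5p4 : {c ℓ : Level} (R : CommutativeRing c ℓ)
    (q Y₀ Y₁ Z : CommutativeRing.Carrier R) (n s : ℕ) →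
    CommutativeRing._≈_ R (Series.LHS R q Y₀ Y₁ Z n s) (Series.RHS R q Y₀ Y₁ Z n s)
proposition5p4 R q Y₀ Y₁ Z n s = begin
  LHS q Y₀ Y₁ Z n s
    ≈⟨ ⊛-termSeries _ fdes (λ w → pow q (fmaj w) * wt w) (B n) s ⟩
  ∑[ w ∈ B n ] guard (does (fdes w ≤? s)) (_ * (pow q (fmaj w) * wt w))
    ≈⟨ ∑∈-filter-cong (signedPerm? n) (words n (letters n)) (λ w → fdes-term≈∑-weights n s w (wt w)) ⟩
  ∑[ w ∈ B n ] ∑[ c ∈ C ] term (c , w)
    ≈⟨ ∑∈-comm (λ w c → term (c , w)) (B n) C ⟩
  ∑[ c ∈ C ] ∑[ w ∈ B n ] term (c , w)
    ≈⟨ ∑∈-cartesianProduct term C (B n) ⟨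
  ∑∈ (cartesianProduct C (B n)) term
    ≈⟨ ∑∈-filter (isWSP? n s) (λ (c , w) → pow q (tot c) * wt w) (cartesianProduct C (B n)) ⟨
  RHS q Y₀ Y₁ Z n s ∎
  where
  open CommutativeRing R hiding (zero)
  open Series R
  open FiniteSums R
  open PowerSeries R
  open Counting R q
  open SetoidReasoning setoid
  wt = weight q Y₀ Y₁ Z
  C = words n (upTo (suc s))
  term = λ (c , w) → guard (does (isWSP? n s (c , w))) (pow q (tot c) * wt w)
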